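{- Let $n\ge 2$ and $1\le t\le n-1$, and put $T=3^t$ and $M=3^{n-t}$. Let $C$ be the ternary code of length $3^n$ with parity check matrix $H_{n,t}$, and let $\mathcal{D}$ be the triple system on $V=\{1,\dots,3^n\}$ whose blocks are the supports of the codewords of weight $3$ in $C$ with all nonzero entries equal to $1$. Then the number $s'(n,t)$ of distinct Steiner triple systems on $V$ all of whose blocks are blocks of $\mathcal{D}$ (these have $3$-rank at most $3^n-n-1+t$) is $$s'(n,t)=N_1(T)^M\cdot N_3(T)^{M(M-1)/6}.$$
   Context: $B_n$ denotes an $n\times 3^n$ ternary matrix whose columns are all the distinct vectors of $\mathrm{GF}(3)^n$. $B_{n,t}$ is the $(n-t)\times 3^n$ matrix obtained from $B_n$ by deleting $t$ rows; its columns consist of every vector of $\mathrm{GF}(3)^{n-t}$ exactly $3^t$ times. $H_{n,t}$ is the $(n-t+1)\times 3^n$ matrix whose first row is the all-one vector and whose remaining rows are those of $B_{n,t}$. $C=\{c\in\mathrm{GF}(3)^{3^n}: H_{n,t}c^{T}=0\}$. A Steiner triple system (STS) on a set $V$ is a collection of $3$-subsets (blocks) such that every $2$-subset of $V$ lies in exactly one block; "distinct" means distinct as sets of blocks on the fixed labeled point set. $N_1(v)$ is the number of distinct Steiner triple systems on a fixed $v$-set. $N_3(g)$ is the number of distinct transversal designs $TD[3;g]$ on three fixed pairwise disjoint groups of size $g$, i.e. sets of $3$-subsets each meeting every group in exactly one point such that any two points from different groups lie in exactly one of these $3$-subsets. The $3$-rank of an STS is the rank over $\mathrm{GF}(3)$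 of its block-by-point incidence matrix. -}

module Defs where

open import Data.Nat using (ℕ; zero; suc; _+_; _*_; _∸_; _^_; _%_)
import Data.Nat.Properties as ℕP
open import Data.Bool using (Bool; true; false; if_then_else_; _∨_)
import Data.Bool.Properties as BP
open import Data.Fin using (Fin; zero; suc; toℕ; _<_)
open import Data.Fin.Properties using (all?; _<?_)
import Data.Fin.Properties as FP
open import Data.Vec using (Vec; lookup)
import Data.Vec.Functional as VF
open import Data.List using (List; []; _∷_; [_]; map; concatMap; filter; length)
open import Data.Product using (_×_; _,_)
open import Relation.Binary.PropositionalEquality using (_≡_; _≢_)
open import Relation.Nullary using (Dec; ¬?)
open import Relation.Nullary.Decidable using (_×-dec_; _→-dec_; ⌊_⌋)
open import Function.Definitions using (Bijective)

sumFin : {m : ℕ} → (Fin m → ℕ) → ℕ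
sumFin {zero}  f = 0
sumFin {suc m} f = f zero + sumFin (λ i → f (suc i))

countFin : {m : ℕ} → (Fin m → Bool) → ℕ
countFin p = sumFin (λ x → if p x then 1 else 0)

allFunsTo : {B : Set} → List B → (a : ℕ) → List (Fin a → B)
allFunsTo bs zero    = [ (λ ()) ]
allFunsTo bs (suc a) = concatMap (λ b → map (λ f → b VF.∷ f) (allFunsTo bs a)) bs

-- X i j k = true encodes that the 3-subset {i,j,k} is a block; a
-- block set is *canonical* if X is true only on strictly increasing
-- triples i < j < k, so canonical X correspond bijectively to sets of
-- 3-subsets of Fin v.

Blocks : ℕ → Set
Blocks v = Fin v → Fin v → Fin v → Bool

allBlocks : (v : ℕ) → List (Blocks v)
allBlocks v = allFunsTo (allFunsTo (allFunsTo (true ∷ false ∷ []) v) v) v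

Canonical : {v : ℕ} → Blocks v → Set
Canonical X = ∀ i j k → X i j k ≡ true → (i < j) × (j < k)

mem : {v : ℕ} → Blocks v → Fin v → Fin v → Fin v → Bool
mem X a b c = X a b c ∨ X a c b ∨ X b a c ∨ X b c a ∨ X c a b ∨ X c b a

IsSTS : {v : ℕ} → Blocks v → Set
IsSTS X = Canonical X × (∀ a b → a ≢ b → countFin (mem X a b) ≡ 1)

canonical? : {v : ℕ} (X : Blocks v) → Dec (Canonical X)
canonical? X = all? λ i → all? λ j → all? λ k →
  (X i j k BP.≟ true) →-dec ((i <? j) ×-dec (j <? k))

isSTS? : {v : ℕ} (X : Blocks v) → Dec (IsSTS X)
isSTS? X = canonical? X ×-dec (all? λ a → all? λ b →
  ¬? (a FP.≟ b) →-dec (countFin (mem X a b) ℕP.≟ 1))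

N₁ : ℕ → ℕ
N₁ v = length (filter isSTS? (allBlocks v))

-- Transversal designs TD[3;g] on the groups {1}×Fin g, {2}×Fin g, {3}×Fin g.
-- A 3-subset meeting every group in exactly one point is
-- {(1,a),(2,b),(3,c)}; Y a b c = true encodes that it is a block.

IsTD : {g : ℕ} → Blocks g → Set
IsTD Y = (∀ a b → countFin (λ c → Y a b c) ≡ 1)
       × (∀ a c → countFin (λ b → Y a b c) ≡ 1)
       × (∀ b c → countFin (λ a → Y a b c) ≡ 1)

isTD? : {g : ℕ} (Y : Blocks g) → Dec (IsTD Y)
isTD? Y = (all? λ a → all? λ b → countFin (λ c → Y a b c) ℕP.≟ 1)
   ×-dec (all? λ a → all? λ c → countFin (λ b → Y a b c) ℕP.≟ 1)
   ×-dec (all? λ b → all? λ c → countFin (λ a → Y a b c) ℕP.≟ 1)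

N₃ : ℕ → ℕ
N₃ g = length (filter isTD? (allBlocks g))

-- The matrices B_n, B_{n,t}, H_{n,t} and the triple system D.
-- σ : Fin (3^n) → Vec (Fin 3) n lists the columns of B_n (a bijection);
-- ρ : Fin (n ∸ t) → Fin n lists, in increasing order, the rows of B_n
-- that are kept (the other t rows are deleted) to form B_{n,t}.

StrictlyIncreasing : {a b : ℕ} → (Fin a → Fin b) → Set
StrictlyIncreasing ρ = ∀ i j → i < j → ρ i < ρ j

-- entries of H_{n,t}: row zero is all ones, row (suc r) is row r of B_{n,t}
H : (n t : ℕ) → (Fin (3 ^ n) → Vec (Fin 3) n) → (Fin (n ∸ t) → Fin n)
  → Fin (suc (n ∸ t)) → Fin (3 ^ n) → ℕ
H n t σ ρ zero    p = 1
H n t σ ρ (suc r) p = toℕ (lookup (σ p) (ρ r))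

ind3 : {m : ℕ} → Fin m → Fin m → Fin m → Fin m → ℕ
ind3 i j k p = if ⌊ p FP.≟ i ⌋ ∨ ⌊ p FP.≟ j ⌋ ∨ ⌊ p FP.≟ k ⌋ then 1 else 0

-- {i,j,k} (i < j < k) is a block of D: the weight-3 vector with entries 1
-- on {i,j,k} is a codeword of C, i.e. H_{n,t} c^T = 0 over GF(3)
InD : (n t : ℕ) → (Fin (3 ^ n) → Vec (Fin 3) n) → (Fin (n ∸ t) → Fin n)
    → Fin (3 ^ n) → Fin (3 ^ n) → Fin (3 ^ n) → Set
InD n t σ ρ i j k = (i < j) × (j < k)
  × (∀ r → sumFin (λ p → H n t σ ρ r p * ind3 i j k p) % 3 ≡ 0)

inD? : (n t : ℕ) (σ : Fin (3 ^ n) → Vec (Fin 3) n) (ρ : Fin (n ∸ t) → Fin n)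
     → ∀ i j k → Dec (InD n t σ ρ i j k)
inD? n t σ ρ i j k = (i <? j) ×-dec (j <? k) ×-dec
  (all? λ r → sumFin (λ p → H n t σ ρ r p * ind3 i j k p) % 3 ℕP.≟ 0)

SubD : (n t : ℕ) → (Fin (3 ^ n) → Vec (Fin 3) n) → (Fin (n ∸ t) → Fin n)
     → Blocks (3 ^ n) → Set
SubD n t σ ρ X = ∀ i j k → X i j k ≡ true → InD n t σ ρ i j k

subD? : (n t : ℕ) (σ : Fin (3 ^ n) → Vec (Fin 3) n) (ρ : Fin (n ∸ t) → Fin n)
      → (X : Blocks (3 ^ n)) → Dec (SubD n t σ ρ X)
subD? n t σ ρ X = all? λ i → all? λ j → all? λ k →
  (X i j k BP.≟ true) →-dec inD? n t σ ρ i j k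

s′ : (n t : ℕ) → (Fin (3 ^ n) → Vec (Fin 3) n) → (Fin (n ∸ t) → Fin n) → ℕ
s′ n t σ ρ = length (filter (λ X → isSTS? X ×-dec subD? n t σ ρ X) (allBlocks (3 ^ n)))

-- Let π send a point of GF(3)^n to its kept coordinates, a point of AG(n − t, 3). The
-- triple {i, j, k} is a block of D exactly when π i + π j + π k = 0, i.e. when the three
-- images are equal or form a line. So a Steiner triple system inside D consists of triples
-- lying in one of the M fibres of π (each of size T) and triples meeting the three fibres
-- over a line transversally. Restricting to a fibre gives an STS on T points, restricting
-- to the three fibres over a line gives a TD[3; T], and conversely every choice of one STS
-- per fibre and one TD per line glues to an STS: a pair inside a fibre is covered there, a
-- pair in two fibres by the TD over the line through their images. Hence
-- s′ = N₁(T)^M · N₃(T)^L, where L = M(M − 1)/6 is the number of lines of AG(n − t, 3),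
-- since every ordered pair of distinct points lies on exactly one line and every line
-- carries six ordered pairs.
--
-- Block sets are counted as Boolean functions on triple codes; the correspondence is an
-- injective map ι from (M + L)·T³ slots to triple codes, off whose image no block of a
-- system in D can lie and on whose image the defining condition factorises over fibres
-- and lines.

module Submission where

open import Defs
open import Data.Nat using (ℕ; zero; suc; _<ᵇ_; _+_; _*_; _∸_; _^_; _≤_; z≤n; s≤s; _%_; _/_)
import Data.Nat as N
open import Data.Nat.Properties using (+-assoc; *-distribˡ-+; *-zeroʳ; *-identityʳ; +-identityʳ; *-comm)
import Data.Nat.Properties as NP
open import Data.Nat.DivMod using (m*n/n≡m)
open import Data.Nat.Tactic.RingSolver using (solve-∀)
open import Data.Bool using (Bool; true; false; if_then_else_; _∨_; _∧_; not)
open import Data.Bool.Properties using (∨-commutativeMonoid; not-involutive)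
open import Algebra.Solver.CommutativeMonoid ∨-commutativeMonoid using (solve; _⊕_; _⊜_)
open import Data.Fin as F using (Fin; zero; suc; toℕ; _↑ˡ_; _↑ʳ_; combine; remQuot; punchIn; punchOut; splitAt)
import Data.Fin.Properties as FP
open import Data.Vec using (Vec; []; _∷_; lookup; tabulate)
import Data.Vec.Properties as VP
open import Data.Vec.Functional using () renaming (_∷_ to _∷ᶠ_)
open import Data.List using (List; []; _∷_; map; concatMap; filter; length; _++_)
open import Data.Product using (Σ; _,_; proj₁; proj₂; _×_)
open import Data.Sum using (_⊎_; inj₁; inj₂; [_,_]′)
open import Data.Empty using (⊥; ⊥-elim)
open import Relation.Binary using (tri<; tri≈; tri>)
open import Relation.Binary.PropositionalEquality
open import Relation.Nullary using (Dec; yes; no)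
open import Relation.Nullary.Decidable using (⌊_⌋; _×-dec_)
open import Function.Definitions using (Bijective)

true≢false : true ≢ false
true≢false ()

cong₃ : ∀ {A B C D : Set} (f : A → B → C → D) {x x′ y y′ z z′} → x ≡ x′ → y ≡ y′ → z ≡ z′ → f x y z ≡ f x′ y′ z′
cong₃ f refl refl refl = refl

subst₃ : ∀ {A : Set} (P : A → A → A → Set) {a a′ b b′ c c′} → a ≡ a′ → b ≡ b′ → c ≡ c′ → P a b c → P a′ b′ c′
subst₃ P refl refl refl p = p

𝟙 : Bool → ℕ
𝟙 b = if b then 1 else 0

eqb : ∀ {m} → Fin m → Fin m → Bool
eqb zero zero = true
eqb zero (suc j) = false
eqb (suc i) zero = false
eqb (suc i) (suc j) = eqb i j

eqb-refl : ∀ {m} (i : Fin m) → eqb i i ≡ true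
eqb-refl zero = refl
eqb-refl (suc i) = eqb-refl i

eqb-true : ∀ {m} (i j : Fin m) → eqb i j ≡ true → i ≡ j
eqb-true zero zero _ = refl
eqb-true (suc i) (suc j) e = cong suc (eqb-true i j e)

eqb-false : ∀ {m} (i j : Fin m) → i ≢ j → eqb i j ≡ false
eqb-false zero zero ne = ⊥-elim (ne refl)
eqb-false zero (suc j) ne = refl
eqb-false (suc i) zero ne = refl
eqb-false (suc i) (suc j) ne = eqb-false i j (λ e → ne (cong suc e))

eqb-sym : ∀ {m} (i j : Fin m) → eqb i j ≡ eqb j i
eqb-sym zero zero = refl
eqb-sym zero (suc j) = refl
eqb-sym (suc i) zero = refl
eqb-sym (suc i) (suc j) = eqb-sym i j

sumFin-cong : ∀ {m} {f g : Fin m → ℕ} → (∀ i → f i ≡ g i) → sumFin f ≡ sumFin g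
sumFin-cong {zero} _ = refl
sumFin-cong {suc m} e = cong₂ _+_ (e zero) (sumFin-cong (λ i → e (suc i)))

sumFin-+ : ∀ {m} (f g : Fin m → ℕ) → sumFin (λ i → f i + g i) ≡ sumFin f + sumFin g
sumFin-+ {zero} f g = refl
sumFin-+ {suc m} f g rewrite sumFin-+ (λ i → f (suc i)) (λ i → g (suc i)) =
  lem (f zero) (g zero) (sumFin (λ i → f (suc i))) (sumFin (λ i → g (suc i)))
  where
  lem : ∀ a b c d → a + b + (c + d) ≡ a + c + (b + d)
  lem = solve-∀

sumFin-* : ∀ {m} (c : ℕ) (f : Fin m → ℕ) → sumFin (λ i → c * f i) ≡ c * sumFin f
sumFin-* {zero} c f = sym (*-zeroʳ c)
sumFin-* {suc m} c f rewrite sumFin-* c (λ i → f (suc i)) = sym (*-distribˡ-+ c (f zero) _)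

sumFin-zero : ∀ {m} → sumFin {m} (λ _ → 0) ≡ 0
sumFin-zero {zero} = refl
sumFin-zero {suc m} = sumFin-zero {m}

sumFin-const : ∀ {m} (c : ℕ) → sumFin {m} (λ _ → c) ≡ m * c
sumFin-const {zero} c = refl
sumFin-const {suc m} c = cong (c +_) (sumFin-const {m} c)

sumFin-↑ : ∀ {a b} (f : Fin (a + b) → ℕ) →
  sumFin f ≡ sumFin (λ i → f (i ↑ˡ b)) + sumFin (λ j → f (a ↑ʳ j))
sumFin-↑ {zero} f = refl
sumFin-↑ {suc a} {b} f rewrite sumFin-↑ {a} {b} (λ i → f (suc i)) =
  sym (+-assoc (f zero) _ _)

sumFin-combine : ∀ {a b} (f : Fin (a * b) → ℕ) →
  sumFin f ≡ sumFin (λ (i : Fin a) → sumFin (λ (j : Fin b) → f (combine i j)))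
sumFin-combine {zero} f = refl
sumFin-combine {suc a} {b} f =
  trans (sumFin-↑ {b} {a * b} f)
        (cong (sumFin (λ j → f (j ↑ˡ (a * b))) +_) (sumFin-combine {a} {b} (λ k → f (b ↑ʳ k))))

sumFin-swap : ∀ {m n} (f : Fin m → Fin n → ℕ) →
  sumFin (λ i → sumFin (λ j → f i j)) ≡ sumFin (λ j → sumFin (λ i → f i j))
sumFin-swap {zero} {n} f = sym (sumFin-zero {n})
sumFin-swap {suc m} {n} f =
  trans (cong (sumFin (f zero) +_) (sumFin-swap (λ i → f (suc i))))
        (sym (sumFin-+ (f zero) (λ j → sumFin (λ i → f (suc i) j))))

sumFin-delta : ∀ {m} (p : Fin m) (h : Fin m → ℕ) →
  sumFin (λ i → 𝟙 (eqb i p) * h i) ≡ h p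
sumFin-delta {suc m} zero h =
  trans (cong₂ _+_ (+-identityʳ (h zero)) (sumFin-zero {m})) (+-identityʳ (h zero))
sumFin-delta {suc m} (suc p) h = sumFin-delta p (λ i → h (suc i))

sumFin-delta′ : ∀ {m} (p : Fin m) (h : Fin m → ℕ) →
  sumFin (λ i → 𝟙 (eqb p i) * h i) ≡ h p
sumFin-delta′ p h = trans (sumFin-cong (λ i → cong (λ b → 𝟙 b * h i) (eqb-sym p i))) (sumFin-delta p h)

sumFin-point : ∀ {n} (p : Fin (suc n)) (f : Fin (suc n) → ℕ) →
  sumFin f ≡ f p + sumFin (λ j → f (punchIn p j))
sumFin-point zero f = refl
sumFin-point {suc n} (suc p) f rewrite sumFin-point p (λ j → f (suc j)) =
  lem (f zero) (f (suc p)) _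
  where
  lem : ∀ a b c → a + (b + c) ≡ b + (a + c)
  lem = solve-∀

IsInjective : ∀ {k N} → (Fin k → Fin N) → Set
IsInjective e = ∀ x y → e x ≡ e y → x ≡ y

anyFin : ∀ {k} (P : Fin k → Bool) → Bool
anyFin {zero} P = false
anyFin {suc k} P = P zero ∨ anyFin (λ i → P (suc i))

anyFin-true : ∀ {k} (P : Fin k → Bool) → anyFin P ≡ true → Σ (Fin k) λ i → P i ≡ true
anyFin-true {suc k} P e with P zero in eq
... | true = zero , eq
... | false with anyFin-true (λ i → P (suc i)) e
... | i , q = suc i , q

anyFin-false : ∀ {k} (P : Fin k → Bool) → anyFin P ≡ false → ∀ i → P i ≡ false
anyFin-false {suc k} P e zero with P zero
anyFin-false {suc k} P e zero | false = refl
anyFin-false {suc k} P e (suc i) with P zero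
anyFin-false {suc k} P e (suc i) | false = anyFin-false (λ i → P (suc i)) e i

inImage : ∀ {k N} → (Fin k → Fin N) → Fin N → Bool
inImage e p = anyFin (λ i → eqb (e i) p)

sumFin-support : ∀ {k N} (e : Fin k → Fin N) → IsInjective e → (f : Fin N → ℕ) →
  (∀ p → (∀ i → e i ≢ p) → f p ≡ 0) → sumFin f ≡ sumFin (λ i → f (e i))
sumFin-support {k} {N} e inj f hf =
  trans (sumFin-cong pt)
  (trans (sumFin-swap (λ p i → 𝟙 (eqb (e i) p) * f p))
         (sumFin-cong (λ i → sumFin-delta′ (e i) f)))
  where
  pt : ∀ p → f p ≡ sumFin (λ i → 𝟙 (eqb (e i) p) * f p)
  pt p with inImage e p in eq
  ... | true with anyFin-true (λ i → eqb (e i) p) eq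
  ... | i0 , q with eqb-true (e i0) p q
  ... | refl = sym (trans (sumFin-cong (λ i → cong (λ b → 𝟙 b * f (e i0)) (lem i)))
                          (sumFin-delta i0 (λ _ → f (e i0))))
    where
    lem : ∀ i → eqb (e i) (e i0) ≡ eqb i i0
    lem i with eqb i i0 in eq2
    ... | true rewrite eqb-true i i0 eq2 = eqb-refl (e i0)
    ... | false = eqb-false (e i) (e i0)
          (λ ee → true≢false (trans (sym (eqb-refl i0)) (subst (λ x → eqb x i0 ≡ false) (inj i i0 ee) eq2)))
  pt p | false = trans (hf p (λ i ee → true≢false (trans (sym (eqb-fromEq ee)) (anyFin-false (λ i → eqb (e i) p) eq i))))
                       (sym (trans (sumFin-cong (λ i → cong (λ b → 𝟙 b * f p) (anyFin-false (λ i → eqb (e i) p) eq i)))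
                                   (sumFin-zero {k})))
    where
    eqb-fromEq : ∀ {a b : Fin N} → a ≡ b → eqb a b ≡ true
    eqb-fromEq {a} refl = eqb-refl a


sumFunctions : ∀ {B : Set} → ((B → ℕ) → ℕ) → (a : ℕ) → ((Fin a → B) → ℕ) → ℕ
sumFunctions S zero h = h (λ ())
sumFunctions S (suc a) h = S (λ b → sumFunctions S a (λ f → h (b ∷ᶠ f)))

sumBool : (Bool → ℕ) → ℕ
sumBool H = H true + (H false + 0)

sumSubsets : (a : ℕ) → ((Fin a → Bool) → ℕ) → ℕ
sumSubsets = sumFunctions sumBool

Extensional : ∀ {B : Set} → ((B → ℕ) → ℕ) → Set
Extensional {B} S = ∀ (H H' : B → ℕ) → (∀ b → H b ≡ H' b) → S H ≡ S H'

sumBool-ext : Extensional sumBool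
sumBool-ext H H' e = cong₂ (λ x y → x + (y + 0)) (e true) (e false)

sumFunctions-cong : ∀ {B : Set} {S : (B → ℕ) → ℕ} → Extensional S → ∀ a (h h' : (Fin a → B) → ℕ) →
  (∀ f → h f ≡ h' f) → sumFunctions S a h ≡ sumFunctions S a h'
sumFunctions-cong ext zero h h' e = e _
sumFunctions-cong ext (suc a) h h' e = ext _ _ (λ b → sumFunctions-cong ext a _ _ (λ f → e (b ∷ᶠ f)))

sumFunctions-ext : ∀ {B : Set} {S : (B → ℕ) → ℕ} → Extensional S → ∀ a → Extensional (sumFunctions S a)
sumFunctions-ext ext a h h' e = sumFunctions-cong ext a h h' e

sumSubsets-cong : ∀ a {h h' : (Fin a → Bool) → ℕ} → (∀ f → h f ≡ h' f) → sumSubsets a h ≡ sumSubsets a h'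
sumSubsets-cong a {h} {h'} e = sumFunctions-cong sumBool-ext a h h' e

sumFunctions-congˢ : ∀ {B : Set} {S S' : (B → ℕ) → ℕ} → Extensional S' → (∀ H → S H ≡ S' H) → ∀ a h →
  sumFunctions S a h ≡ sumFunctions S' a h
sumFunctions-congˢ ext' e zero h = refl
sumFunctions-congˢ {S = S} {S'} ext' e (suc a) h =
  trans (e _) (ext' _ _ (λ b → sumFunctions-congˢ ext' e a (λ f → h (b ∷ᶠ f))))

RespectsPointwise : ∀ {B : Set} {a : ℕ} → ((Fin a → B) → ℕ) → Set
RespectsPointwise {B} {a} h = ∀ (f f' : Fin a → B) → (∀ i → f i ≡ f' i) → h f ≡ h f'

sumSubsets-zero : ∀ a → sumSubsets a (λ _ → 0) ≡ 0
sumSubsets-zero zero = refl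
sumSubsets-zero (suc a) rewrite sumSubsets-zero a = refl

sumSubsets-* : ∀ a c (h : (Fin a → Bool) → ℕ) → sumSubsets a (λ f → c * h f) ≡ c * sumSubsets a h
sumSubsets-* zero c h = refl
sumSubsets-* (suc a) c h rewrite sumSubsets-* a c (λ f → h (true ∷ᶠ f)) | sumSubsets-* a c (λ f → h (false ∷ᶠ f)) =
  lem c _ _
  where
  lem : ∀ c x y → c * x + (c * y + 0) ≡ c * (x + (y + 0))
  lem = solve-∀

insertAt : ∀ {N} {B : Set} → Fin (suc N) → B → (Fin N → B) → Fin (suc N) → B
insertAt zero b W = b ∷ᶠ W
insertAt {suc N} (suc p) b W = W zero ∷ᶠ insertAt p b (λ i → W (suc i))

insertAt-at : ∀ {N} {B : Set} (p : Fin (suc N)) (b : B) W → insertAt p b W p ≡ b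
insertAt-at zero b W = refl
insertAt-at {suc N} (suc p) b W = insertAt-at p b (λ i → W (suc i))

insertAt-punchIn : ∀ {N} {B : Set} (p : Fin (suc N)) (b : B) W v → insertAt p b W (punchIn p v) ≡ W v
insertAt-punchIn zero b W v = refl
insertAt-punchIn {suc N} (suc p) b W zero = refl
insertAt-punchIn {suc N} (suc p) b W (suc v) = insertAt-punchIn p b (λ i → W (suc i)) v

insertAt-cong : ∀ {N} {B : Set} (p : Fin (suc N)) (b : B) W W' → (∀ i → W i ≡ W' i) →
  ∀ j → insertAt p b W j ≡ insertAt p b W' j
insertAt-cong zero b W W' e zero = refl
insertAt-cong zero b W W' e (suc j) = e j
insertAt-cong {suc N} (suc p) b W W' e zero = e zero
insertAt-cong {suc N} (suc p) b W W' e (suc j) = insertAt-cong p b _ _ (λ i → e (suc i)) j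

sumSubsets-insertAt : ∀ N (p : Fin (suc N)) (F : (Fin (suc N) → Bool) → ℕ) →
  sumSubsets (suc N) F ≡ sumBool (λ b → sumSubsets N (λ W → F (insertAt p b W)))
sumSubsets-insertAt N zero F = refl
sumSubsets-insertAt (suc N) (suc p) F
  rewrite sumSubsets-insertAt N p (λ W → F (true ∷ᶠ W)) | sumSubsets-insertAt N p (λ W → F (false ∷ᶠ W)) =
  lem (sumSubsets N (λ W → F (true ∷ᶠ insertAt p true W))) (sumSubsets N (λ W → F (true ∷ᶠ insertAt p false W)))
      (sumSubsets N (λ W → F (false ∷ᶠ insertAt p true W))) (sumSubsets N (λ W → F (false ∷ᶠ insertAt p false W)))
  where
  lem : ∀ a b c d → (a + (b + 0)) + ((c + (d + 0)) + 0) ≡ (a + (c + 0)) + ((b + (d + 0)) + 0)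
  lem = solve-∀

OffImage : ∀ {k N} → (Fin k → Fin N) → Fin N → Set
OffImage ι r = ∀ u → ι u ≢ r

-- Induction on N. If ι misses 0, the subsets containing 0 contribute nothing and ι factors
-- through suc; if ι u₀ = 0, the value of W at 0 is paired with the value at u₀ (sumSubsets-insertAt).
sumSubsets-support : ∀ N {k} (ι : Fin k → Fin N) → IsInjective ι →
  (F : (Fin N → Bool) → ℕ) (G : (Fin k → Bool) → ℕ) → RespectsPointwise G →
  (∀ W → (∀ r → OffImage ι r → W r ≡ false) → F W ≡ G (λ u → W (ι u))) →
  (∀ W r → OffImage ι r → W r ≡ true → F W ≡ 0) →
  sumSubsets N F ≡ sumSubsets k G

sumSubsets-support-0∉image : ∀ N {k} (ι : Fin k → Fin (suc N)) → IsInjective ι → (∀ u → ι u ≢ zero) →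
  (F : (Fin (suc N) → Bool) → ℕ) (G : (Fin k → Bool) → ℕ) → RespectsPointwise G →
  (∀ W → (∀ r → OffImage ι r → W r ≡ false) → F W ≡ G (λ u → W (ι u))) →
  (∀ W r → OffImage ι r → W r ≡ true → F W ≡ 0) →
  sumSubsets (suc N) F ≡ sumSubsets k G
sumSubsets-support-0∉image N {k} ι inj noZ F G rG agree vanish =
  trans (cong₂ (λ x y → x + (y + 0)) part1 part2) (+-identityʳ _)
  where
  ι' : Fin k → Fin N
  ι' u = punchOut {i = zero} {j = ι u} (λ e → noZ u (sym e))
  sι : ∀ u → suc (ι' u) ≡ ι u
  sι u = FP.punchIn-punchOut {i = zero} {j = ι u} (λ e → noZ u (sym e))
  inj' : IsInjective ι'
  inj' x y e = inj x y (trans (sym (sι x)) (trans (cong suc e) (sι y)))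
  off : ∀ r' → OffImage ι' r' → OffImage ι (suc r')
  off r' o u e = o u (FP.suc-injective (trans (sι u) e))
  part1 : sumSubsets N (λ W → F (true ∷ᶠ W)) ≡ 0
  part1 = trans (sumSubsets-cong N (λ W → vanish (true ∷ᶠ W) zero noZ refl)) (sumSubsets-zero N)
  part2 : sumSubsets N (λ W → F (false ∷ᶠ W)) ≡ sumSubsets k G
  part2 = sumSubsets-support N ι' inj' (λ W → F (false ∷ᶠ W)) G rG
    (λ W hW → trans (agree (false ∷ᶠ W) (λ { zero _ → refl ; (suc r) o → hW r (λ u e → o u (trans (sym (sι u)) (cong suc e))) }))
                    (rG _ _ (λ u → trans (cong (false ∷ᶠ W) (sym (sι u))) refl)))
    (λ W r o t → vanish (false ∷ᶠ W) (suc r) (off r o) t)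

sumSubsets-support-0∈image : ∀ N {k} (ι : Fin k → Fin (suc N)) → IsInjective ι →
  (u0 : Fin k) → ι u0 ≡ zero →
  (F : (Fin (suc N) → Bool) → ℕ) (G : (Fin k → Bool) → ℕ) → RespectsPointwise G →
  (∀ W → (∀ r → OffImage ι r → W r ≡ false) → F W ≡ G (λ u → W (ι u))) →
  (∀ W r → OffImage ι r → W r ≡ true → F W ≡ 0) →
  sumSubsets (suc N) F ≡ sumSubsets k G
sumSubsets-support-0∈image N {suc k'} ι inj u0 z0 F G rG agree vanish =
  trans (sumBool-ext _ _ each) (sym (sumSubsets-insertAt k' u0 G))
  where
  nz : ∀ v → ι (punchIn u0 v) ≢ zero
  nz v e = FP.punchInᵢ≢i u0 v (inj _ _ (trans e (sym z0)))
  ι' : Fin k' → Fin N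
  ι' v = punchOut {i = zero} {j = ι (punchIn u0 v)} (λ e → nz v (sym e))
  sι : ∀ v → suc (ι' v) ≡ ι (punchIn u0 v)
  sι v = FP.punchIn-punchOut {i = zero} {j = ι (punchIn u0 v)} (λ e → nz v (sym e))
  inj' : IsInjective ι'
  inj' x y e = FP.punchIn-injective u0 x y
    (inj _ _ (trans (sym (sι x)) (trans (cong suc e) (sι y))))
  split : ∀ (u : Fin (suc k')) → (u ≡ u0) ⊎ (Σ (Fin k') λ v → punchIn u0 v ≡ u)
  split u with u FP.≟ u0
  ... | yes e = inj₁ e
  ... | no ne = inj₂ (punchOut {i = u0} {j = u} (λ e → ne (sym e)) ,
                     FP.punchIn-punchOut {i = u0} {j = u} (λ e → ne (sym e)))
  offS : ∀ r' → OffImage ι' r' → OffImage ι (suc r')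
  offS r' o u e with split u
  ... | inj₁ refl = FP.0≢1+n (trans (sym z0) e)
  ... | inj₂ (v , refl) = o v (FP.suc-injective (trans (sι v) e))
  each : ∀ b → sumSubsets N (λ W → F (b ∷ᶠ W)) ≡ sumSubsets k' (λ Y → G (insertAt u0 b Y))
  each b = sumSubsets-support N ι' inj' (λ W → F (b ∷ᶠ W)) (λ Y → G (insertAt u0 b Y))
    (λ Y Y' e → rG _ _ (insertAt-cong u0 b Y Y' e))
    (λ W hW → trans (agree (b ∷ᶠ W) (λ { zero o → ⊥-elim (o u0 z0)
                                    ; (suc r) o → hW r (λ v e → o (punchIn u0 v) (trans (sym (sι v)) (cong suc e))) }))
                    (rG _ _ (pt W)))
    (λ W r o t → vanish (b ∷ᶠ W) (suc r) (offS r o) t)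
    where
    pt : ∀ W u → (b ∷ᶠ W) (ι u) ≡ insertAt u0 b (λ v → W (ι' v)) u
    pt W u with split u
    ... | inj₁ refl = trans (cong (b ∷ᶠ W) z0) (sym (insertAt-at u0 b _))
    ... | inj₂ (v , refl) = trans (cong (b ∷ᶠ W) (sym (sι v))) (sym (insertAt-punchIn u0 b _ v))

sumSubsets-support zero {zero} ι inj F G rG agree vanish = trans (agree _ (λ ())) (rG _ _ (λ ()))
sumSubsets-support zero {suc k} ι inj F G rG agree vanish with ι zero
... | ()
sumSubsets-support (suc N) {k} ι inj F G rG agree vanish with inImage ι zero in eq
... | false = sumSubsets-support-0∉image N ι inj noZ F G rG agree vanish
  where
  noZ : ∀ u → ι u ≢ zero
  noZ u e = true≢false (trans (sym (subst (λ x → eqb x zero ≡ true) (sym e) refl))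
                      (anyFin-false (λ i → eqb (ι i) zero) eq u))
... | true with anyFin-true (λ i → eqb (ι i) zero) eq
... | u0 , q = sumSubsets-support-0∈image N ι inj u0 (eqb-true _ _ q) F G rG agree vanish

sumSubsets-↑ : ∀ a b (F : (Fin a → Bool) → ℕ) (G : (Fin b → Bool) → ℕ) → RespectsPointwise F →
  sumSubsets (a + b) (λ W → F (λ i → W (i ↑ˡ b)) * G (λ j → W (a ↑ʳ j))) ≡ sumSubsets a F * sumSubsets b G
sumSubsets-↑ zero b F G rF =
  trans (sumSubsets-cong b (λ W → cong (_* G W) (rF _ _ (λ ())))) (sumSubsets-* b (F (λ ())) G)
sumSubsets-↑ (suc a) b F G rF =
  trans (cong₂ (λ x y → x + (y + 0)) (e true) (e false))
        (lem (sumSubsets a (λ f → F (true ∷ᶠ f))) (sumSubsets a (λ f → F (false ∷ᶠ f))) (sumSubsets b G))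
  where
  lem : ∀ x y z → x * z + (y * z + 0) ≡ (x + (y + 0)) * z
  lem = solve-∀
  e : ∀ c → sumSubsets (a + b) (λ W → F (λ i → (c ∷ᶠ W) (i ↑ˡ b)) * G (λ j → W (a ↑ʳ j)))
          ≡ sumSubsets a (λ f → F (c ∷ᶠ f)) * sumSubsets b G
  e c = trans (sumSubsets-cong (a + b) (λ W → cong (_* G (λ j → W (a ↑ʳ j)))
                 (rF _ _ (λ { zero → refl ; (suc i) → refl }))))
              (sumSubsets-↑ a b (λ f → F (c ∷ᶠ f)) G (λ f f' q → rF _ _ (λ { zero → refl ; (suc i) → q i })))

productFin : (K : ℕ) → (Fin K → ℕ) → ℕ
productFin zero f = 1
productFin (suc K) f = f zero * productFin K (λ q → f (suc q))

productFin-const : ∀ K c → productFin K (λ _ → c) ≡ c ^ K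
productFin-const zero c = refl
productFin-const (suc K) c = cong (c *_) (productFin-const K c)

productFin-cong : ∀ K {f g : Fin K → ℕ} → (∀ q → f q ≡ g q) → productFin K f ≡ productFin K g
productFin-cong zero e = refl
productFin-cong (suc K) e = cong₂ _*_ (e zero) (productFin-cong K (λ q → e (suc q)))

sumSubsets-combine : ∀ K T (F : Fin K → (Fin T → Bool) → ℕ) → (∀ q → RespectsPointwise (F q)) →
  sumSubsets (K * T) (λ W → productFin K (λ q → F q (λ w → W (combine q w)))) ≡ productFin K (λ q → sumSubsets T (F q))
sumSubsets-combine zero T F rF = refl
sumSubsets-combine (suc K) T F rF =
  trans (sumSubsets-↑ T (K * T) (F zero) (λ W → productFin K (λ q → F (suc q) (λ w → W (combine q w)))) (rF zero))
        (cong (sumSubsets T (F zero) *_) (sumSubsets-combine K T (λ q → F (suc q)) (λ q → rF (suc q))))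

sumSubsets-power : ∀ K T (F : (Fin T → Bool) → ℕ) → RespectsPointwise F →
  sumSubsets (K * T) (λ W → productFin K (λ q → F (λ w → W (combine q w)))) ≡ sumSubsets T F ^ K
sumSubsets-power K T F rF = trans (sumSubsets-combine K T (λ _ → F) (λ _ → rF)) (productFin-const K (sumSubsets T F))

sumList : {A : Set} → List A → (A → ℕ) → ℕ
sumList [] h = 0
sumList (x ∷ xs) h = h x + sumList xs h

sumList-ext : {A : Set} (L : List A) → Extensional (sumList L)
sumList-ext [] H H' e = refl
sumList-ext (x ∷ L) H H' e = cong₂ _+_ (e x) (sumList-ext L H H' e)

sumList-++ : {A : Set} (L L' : List A) (h : A → ℕ) → sumList (L ++ L') h ≡ sumList L h + sumList L' h
sumList-++ [] L' h = refl
sumList-++ (x ∷ L) L' h = trans (cong (h x +_) (sumList-++ L L' h)) (sym (+-assoc (h x) _ _))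

sumList-map : {A B : Set} (f : A → B) (L : List A) (h : B → ℕ) → sumList (map f L) h ≡ sumList L (λ x → h (f x))
sumList-map f [] h = refl
sumList-map f (x ∷ L) h = cong (h (f x) +_) (sumList-map f L h)

sumList-concatMap : {A B : Set} (g : A → List B) (L : List A) (h : B → ℕ) →
  sumList (concatMap g L) h ≡ sumList L (λ x → sumList (g x) h)
sumList-concatMap g [] h = refl
sumList-concatMap g (x ∷ L) h =
  trans (sumList-++ (g x) (concatMap g L) h) (cong (sumList (g x) h +_) (sumList-concatMap g L h))

length-filter : {A : Set} {P : A → Set} (P? : ∀ x → Dec (P x)) (L : List A) →
  length (filter P? L) ≡ sumList L (λ x → 𝟙 ⌊ P? x ⌋)
length-filter P? [] = refl
length-filter P? (x ∷ L) with P? x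
... | yes _ = cong suc (length-filter P? L)
... | no _ = length-filter P? L

sumList-allFunsTo : {B : Set} (bs : List B) (a : ℕ) (h : (Fin a → B) → ℕ) → sumList (allFunsTo bs a) h ≡ sumFunctions (sumList bs) a h
sumList-allFunsTo bs zero h = +-identityʳ _
sumList-allFunsTo bs (suc a) h =
  trans (sumList-concatMap _ bs h)
  (sumList-ext bs _ _ (λ b → trans (sumList-map (b ∷ᶠ_) (allFunsTo bs a) h)
                                (sumList-allFunsTo bs a (λ f → h (b ∷ᶠ f)))))

append : ∀ {B : Set} {b c} → (Fin b → B) → (Fin c → B) → Fin (b + c) → B
append {b = zero} g W = W
append {b = suc b} g W = g zero ∷ᶠ append (λ i → g (suc i)) W

append-↑ˡ : ∀ {B : Set} {b c} (g : Fin b → B) (W : Fin c → B) i → append g W (i ↑ˡ c) ≡ g i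
append-↑ˡ {b = suc b} g W zero = refl
append-↑ˡ {b = suc b} g W (suc i) = append-↑ˡ (λ i → g (suc i)) W i

append-↑ʳ : ∀ {B : Set} {b c} (g : Fin b → B) (W : Fin c → B) k → append g W (b ↑ʳ k) ≡ W k
append-↑ʳ {b = zero} g W k = refl
append-↑ʳ {b = suc b} g W k = append-↑ʳ (λ i → g (suc i)) W k

sumFunctions-append : ∀ {B : Set} (S : (B → ℕ) → ℕ) → Extensional S → ∀ b c (H : (Fin (b + c) → B) → ℕ) →
  sumFunctions S (b + c) H ≡ sumFunctions S b (λ g → sumFunctions S c (λ W → H (append g W)))
sumFunctions-append S ext zero c H = refl
sumFunctions-append S ext (suc b) c H = ext _ _ (λ x → sumFunctions-append S ext b c (λ f → H (x ∷ᶠ f)))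

RespectsPointwise₂ : ∀ {B : Set} {a b : ℕ} → ((Fin a → Fin b → B) → ℕ) → Set
RespectsPointwise₂ {B} {a} {b} h = ∀ (f f' : Fin a → Fin b → B) → (∀ i j → f i j ≡ f' i j) → h f ≡ h f'

sumFunctions-curry : ∀ {B : Set} (S : (B → ℕ) → ℕ) → Extensional S → ∀ a b (h : (Fin a → Fin b → B) → ℕ) → RespectsPointwise₂ h →
  sumFunctions (sumFunctions S b) a h ≡ sumFunctions S (a * b) (λ W → h (λ i j → W (combine i j)))
sumFunctions-curry S ext zero b h rh = rh _ _ (λ ())
sumFunctions-curry S ext (suc a) b h rh =
  trans (sumFunctions-ext ext b _ _ (λ g → sumFunctions-curry S ext a b (λ f → h (g ∷ᶠ f))
                                   (λ f f' e → rh _ _ (λ { zero j → refl ; (suc i) j → e i j }))))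
        (sym (trans (sumFunctions-append S ext b (a * b) _)
                    (sumFunctions-ext ext b _ _ (λ g → sumFunctions-cong ext (a * b) _ _
                        (λ W → rh _ _ (λ { zero j → append-↑ˡ g W j ; (suc i) j → append-↑ʳ g W (combine i j) }))))))

unflatten : ∀ {v} → (Fin ((v * v) * v) → Bool) → Blocks v
unflatten W i j k = W (combine (combine i j) k)

RespectsPointwise₃ : ∀ {v} → (Blocks v → ℕ) → Set
RespectsPointwise₃ {v} h = ∀ X X' → (∀ i j k → X i j k ≡ X' i j k) → h X ≡ h X'

sumBlocks : ∀ v (h : Blocks v → ℕ) → RespectsPointwise₃ h →
  sumList (allBlocks v) h ≡ sumSubsets ((v * v) * v) (λ W → h (unflatten W))
sumBlocks v h rh =
  trans (sumList-allFunsTo L2 v h)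
  (trans (sumFunctions-congˢ (sumFunctions-ext (sumList-ext L1) v) (λ H → sumList-allFunsTo L1 v H) v h)
  (trans (sumFunctions-curry (sumList L1) (sumList-ext L1) v v h (λ f f' e → rh _ _ (λ i j k → cong (λ g → g k) (e i j))))
  (trans (sumFunctions-congˢ (sumFunctions-ext sumBool-ext v) (λ H → sumList-allFunsTo bools v H) (v * v) _)
         (sumFunctions-curry sumBool sumBool-ext (v * v) v _ (λ f f' e → rh _ _ (λ i j k → e (combine i j) k))))))
  where
  bools : List Bool
  bools = true ∷ false ∷ []
  L1 = allFunsTo bools v
  L2 = allFunsTo L1 v

countBlocks : ∀ v {P : Blocks v → Set} (P? : ∀ X → Dec (P X)) → RespectsPointwise₃ (λ X → 𝟙 ⌊ P? X ⌋) →
  length (filter P? (allBlocks v)) ≡ sumSubsets ((v * v) * v) (λ W → 𝟙 ⌊ P? (unflatten W) ⌋)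
countBlocks v P? r = trans (length-filter P? (allBlocks v)) (sumBlocks v _ r)

-- Fibres are listed in increasing order so that increasing triples of Fin T are sent to
-- increasing triples of points, which is what Canonical block sets need.
record OrderedEnumeration {N : ℕ} (P : Fin N → Bool) (c : ℕ) : Set where
  field
    e : Fin c → Fin N
    eP : ∀ x → P (e x) ≡ true
    mono : ∀ x y → x F.< y → e x F.< e y
    surj : ∀ p → P p ≡ true → Σ (Fin c) λ x → e x ≡ p

enumerate-step : ∀ {N c} (b : Bool) → (Fin c → Fin N) → Fin (𝟙 b + c) → Fin (suc N)
enumerate-step true e zero = zero
enumerate-step true e (suc x) = suc (e x)
enumerate-step false e x = suc (e x)

enumerate : ∀ {N} (P : Fin N → Bool) → OrderedEnumeration P (countFin P)
enumerate {zero} P = record { e = λ () ; eP = λ () ; mono = λ () ; surj = λ () }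
enumerate {suc N} P = record
  { e = enumerate-step (P zero) E.e
  ; eP = goP (P zero) refl
  ; mono = goM (P zero)
  ; surj = goS (P zero) refl }
  where
  module E = OrderedEnumeration (enumerate (λ i → P (suc i)))
  c = countFin (λ i → P (suc i))
  goP : ∀ b → b ≡ P zero → ∀ (x : Fin (𝟙 b + c)) → P (enumerate-step b E.e x) ≡ true
  goP true q zero = sym q
  goP true q (suc x) = E.eP x
  goP false q x = E.eP x
  goM : ∀ b (x y : Fin (𝟙 b + c)) → x F.< y → enumerate-step b E.e x F.< enumerate-step b E.e y
  goM true zero (suc y) _ = s≤s z≤n
  goM true (suc x) (suc y) (s≤s lt) = s≤s (E.mono x y lt)
  goM false x y lt = s≤s (E.mono x y lt)
  goS : ∀ b → b ≡ P zero → ∀ p → P p ≡ true → Σ (Fin (𝟙 b + c)) λ x → enumerate-step b E.e x ≡ p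
  goS true q zero t = zero , refl
  goS false q zero t with trans q t
  ... | ()
  goS true q (suc p) t with E.surj p t
  ... | x , r = suc x , cong suc r
  goS false q (suc p) t with E.surj p t
  ... | x , r = x , cong suc r

enumerate-of-size : ∀ {N} (P : Fin N → Bool) c → countFin P ≡ c → OrderedEnumeration P c
enumerate-of-size P c eq = subst (OrderedEnumeration P) eq (enumerate P)

module OrderedEnumerationProperties {N : ℕ} {P : Fin N → Bool} {c : ℕ} (En : OrderedEnumeration P c) where
  open OrderedEnumeration En
  inj : ∀ x y → e x ≡ e y → x ≡ y
  inj x y q with FP.<-cmp x y
  ... | tri≈ _ r _ = r
  ... | tri< lt _ _ = ⊥-elim (FP.<-irrefl q (mono x y lt))
  ... | tri> _ _ gt = ⊥-elim (FP.<-irrefl (sym q) (mono y x gt))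
  reflect : ∀ x y → e x F.< e y → x F.< y
  reflect x y lt with FP.<-cmp x y
  ... | tri< l _ _ = l
  ... | tri≈ _ refl _ = ⊥-elim (FP.<-irrefl refl lt)
  ... | tri> _ _ gt = ⊥-elim (FP.<-asym lt (mono y x gt))

-- third a b = −(a + b) in GF(3).
third : Fin 3 → Fin 3 → Fin 3
third zero zero = zero
third zero (suc zero) = (suc (suc zero))
third zero (suc (suc zero)) = (suc zero)
third (suc zero) zero = (suc (suc zero))
third (suc zero) (suc zero) = (suc zero)
third (suc zero) (suc (suc zero)) = zero
third (suc (suc zero)) zero = (suc zero)
third (suc (suc zero)) (suc zero) = zero
third (suc (suc zero)) (suc (suc zero)) = (suc (suc zero))

third-unique : ∀ a b c → (toℕ a + toℕ b + toℕ c) % 3 ≡ 0 → c ≡ third a b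
third-unique zero zero zero _ = refl
third-unique zero zero (suc zero) ()
third-unique zero zero (suc (suc zero)) ()
third-unique zero (suc zero) zero ()
third-unique zero (suc zero) (suc zero) ()
third-unique zero (suc zero) (suc (suc zero)) _ = refl
third-unique zero (suc (suc zero)) zero ()
third-unique zero (suc (suc zero)) (suc zero) _ = refl
third-unique zero (suc (suc zero)) (suc (suc zero)) ()
third-unique (suc zero) zero zero ()
third-unique (suc zero) zero (suc zero) ()
third-unique (suc zero) zero (suc (suc zero)) _ = refl
third-unique (suc zero) (suc zero) zero ()
third-unique (suc zero) (suc zero) (suc zero) _ = refl
third-unique (suc zero) (suc zero) (suc (suc zero)) ()
third-unique (suc zero) (suc (suc zero)) zero _ = refl
third-unique (suc zero) (suc (suc zero)) (suc zero) ()
third-unique (suc zero) (suc (suc zero)) (suc (suc zero)) ()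
third-unique (suc (suc zero)) zero zero ()
third-unique (suc (suc zero)) zero (suc zero) _ = refl
third-unique (suc (suc zero)) zero (suc (suc zero)) ()
third-unique (suc (suc zero)) (suc zero) zero _ = refl
third-unique (suc (suc zero)) (suc zero) (suc zero) ()
third-unique (suc (suc zero)) (suc zero) (suc (suc zero)) ()
third-unique (suc (suc zero)) (suc (suc zero)) zero ()
third-unique (suc (suc zero)) (suc (suc zero)) (suc zero) ()
third-unique (suc (suc zero)) (suc (suc zero)) (suc (suc zero)) _ = refl

third-sum : ∀ a b → (toℕ a + toℕ b + toℕ (third a b)) % 3 ≡ 0
third-sum zero zero = refl
third-sum zero (suc zero) = refl
third-sum zero (suc (suc zero)) = refl
third-sum (suc zero) zero = refl
third-sum (suc zero) (suc zero) = refl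
third-sum (suc zero) (suc (suc zero)) = refl
third-sum (suc (suc zero)) zero = refl
third-sum (suc (suc zero)) (suc zero) = refl
third-sum (suc (suc zero)) (suc (suc zero)) = refl

third-comm : ∀ a b → third a b ≡ third b a
third-comm zero zero = refl
third-comm zero (suc zero) = refl
third-comm zero (suc (suc zero)) = refl
third-comm (suc zero) zero = refl
third-comm (suc zero) (suc zero) = refl
third-comm (suc zero) (suc (suc zero)) = refl
third-comm (suc (suc zero)) zero = refl
third-comm (suc (suc zero)) (suc zero) = refl
third-comm (suc (suc zero)) (suc (suc zero)) = refl

third-involutive : ∀ a b → third a (third a b) ≡ b
third-involutive zero zero = refl
third-involutive zero (suc zero) = refl
third-involutive zero (suc (suc zero)) = refl
third-involutive (suc zero) zero = refl
third-involutive (suc zero) (suc zero) = refl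
third-involutive (suc zero) (suc (suc zero)) = refl
third-involutive (suc (suc zero)) zero = refl
third-involutive (suc (suc zero)) (suc zero) = refl
third-involutive (suc (suc zero)) (suc (suc zero)) = refl

third-idem : ∀ a → third a a ≡ a
third-idem zero = refl
third-idem (suc zero) = refl
third-idem (suc (suc zero)) = refl

decode : ∀ k → Fin (3 ^ k) → Vec (Fin 3) k
decode zero _ = []
decode (suc k) u = proj₁ (remQuot {3} (3 ^ k) u) ∷ decode k (proj₂ (remQuot {3} (3 ^ k) u))

encode : ∀ {k} → Vec (Fin 3) k → Fin (3 ^ k)
encode [] = zero
encode (x ∷ v) = combine x (encode v)

decode-encode : ∀ {k} (v : Vec (Fin 3) k) → decode k (encode v) ≡ v
decode-encode [] = refl
decode-encode {suc k} (x ∷ v) =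
  trans (cong (λ pr → proj₁ pr ∷ decode k (proj₂ pr)) (FP.remQuot-combine {3} {3 ^ k} x (encode v)))
        (cong (x ∷_) (decode-encode v))

encode-decode : ∀ k (u : Fin (3 ^ k)) → encode (decode k u) ≡ u
encode-decode zero zero = refl
encode-decode (suc k) u =
  trans (cong (combine (proj₁ (remQuot {3} (3 ^ k) u))) (encode-decode k (proj₂ (remQuot {3} (3 ^ k) u))))
        (FP.combine-remQuot {3} (3 ^ k) u)

decode-injective : ∀ k (u u' : Fin (3 ^ k)) → decode k u ≡ decode k u' → u ≡ u'
decode-injective k u u' e = trans (sym (encode-decode k u)) (trans (cong encode e) (encode-decode k u'))

sumFin-decode : ∀ k (f : Vec (Fin 3) (suc k) → ℕ) →
  sumFin (λ (u : Fin (3 ^ suc k)) → f (decode (suc k) u))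
  ≡ sumFin (λ (x : Fin 3) → sumFin (λ (u : Fin (3 ^ k)) → f (x ∷ decode k u)))
sumFin-decode k f = trans (sumFin-combine {3} {3 ^ k} _)
  (sumFin-cong (λ x → sumFin-cong (λ u → cong (λ pr → f (proj₁ pr ∷ decode k (proj₂ pr)))
                                            (FP.remQuot-combine {3} {3 ^ k} x u))))

lookup-ext : ∀ {A : Set} {k} (v w : Vec A k) → (∀ r → lookup v r ≡ lookup w r) → v ≡ w
lookup-ext v w e = trans (sym (VP.tabulate∘lookup v)) (trans (VP.tabulate-cong e) (VP.tabulate∘lookup w))

module AffineSpace (k : ℕ) where
  coords : Fin (3 ^ k) → Vec (Fin 3) k
  coords = decode k

  -- a + b + c = 0 in GF(3)^k: either a = b = c or {a, b, c} is a line of AG(k, 3).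
  Collinear : Fin (3 ^ k) → Fin (3 ^ k) → Fin (3 ^ k) → Set
  Collinear a b c = ∀ r → lookup (coords c) r ≡ third (lookup (coords a) r) (lookup (coords b) r)

  thirdPoint : Fin (3 ^ k) → Fin (3 ^ k) → Fin (3 ^ k)
  thirdPoint a b = encode (tabulate (λ r → third (lookup (coords a) r) (lookup (coords b) r)))

  Collinear-thirdPoint : ∀ a b → Collinear a b (thirdPoint a b)
  Collinear-thirdPoint a b r rewrite decode-encode (tabulate (λ r → third (lookup (coords a) r) (lookup (coords b) r))) =
    VP.lookup∘tabulate _ r

  Collinear-unique : ∀ a b c → Collinear a b c → c ≡ thirdPoint a b
  Collinear-unique a b c l = decode-injective k c (thirdPoint a b) (lookup-ext _ _ (λ r → trans (l r) (sym (Collinear-thirdPoint a b r))))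

  Collinear-swap₁₂ : ∀ a b c → Collinear a b c → Collinear b a c
  Collinear-swap₁₂ a b c l r = trans (l r) (third-comm _ _)

  Collinear-swap₂₃ : ∀ a b c → Collinear a b c → Collinear a c b
  Collinear-swap₂₃ a b c l r = trans (sym (third-involutive _ _)) (cong (third (lookup (coords a) r)) (sym (l r)))

  Collinear-degenerate : ∀ a c → Collinear a a c → c ≡ a
  Collinear-degenerate a c l = decode-injective k c a (lookup-ext _ _ (λ r → trans (l r) (third-idem _)))

  Collinear-refl : ∀ a → Collinear a a a
  Collinear-refl a r = sym (third-idem _)

  collinear? : ∀ a b c → Dec (Collinear a b c)
  collinear? a b c = FP.all? (λ r → lookup (coords c) r FP.≟ third (lookup (coords a) r) (lookup (coords b) r))

  thirdPoint-≢ : ∀ a b → a ≢ b → thirdPoint a b ≢ a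
  thirdPoint-≢ a b ne e = ne (sym (Collinear-degenerate a b (Collinear-swap₂₃ a b a (subst (Collinear a b) e (Collinear-thirdPoint a b)))))

<ᵇ-sound : ∀ x y → (x <ᵇ y) ≡ true → x N.< y
<ᵇ-sound zero (suc y) _ = s≤s z≤n
<ᵇ-sound (suc x) (suc y) e = s≤s (<ᵇ-sound x y e)

<ᵇ-complete : ∀ x y → x N.< y → (x <ᵇ y) ≡ true
<ᵇ-complete zero (suc y) _ = refl
<ᵇ-complete (suc x) (suc y) (s≤s l) = <ᵇ-complete x y l

<ᵇ-irrefl : ∀ x → (x <ᵇ x) ≡ false
<ᵇ-irrefl zero = refl
<ᵇ-irrefl (suc x) = <ᵇ-irrefl x

<ᵇ-flip : ∀ x y → x ≢ y → (y <ᵇ x) ≡ not (x <ᵇ y)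
<ᵇ-flip zero zero ne = ⊥-elim (ne refl)
<ᵇ-flip zero (suc y) ne = refl
<ᵇ-flip (suc x) zero ne = refl
<ᵇ-flip (suc x) (suc y) ne = <ᵇ-flip x y (λ e → ne (cong suc e))

<ᵇ-trans : ∀ x y z → (x <ᵇ y) ≡ true → (y <ᵇ z) ≡ true → (x <ᵇ z) ≡ true
<ᵇ-trans x y z p q = <ᵇ-complete x z (NP.<-trans (<ᵇ-sound x y p) (<ᵇ-sound y z q))

ltF : ∀ {m} → Fin m → Fin m → Bool
ltF a b = toℕ a <ᵇ toℕ b

𝟙-∧ : ∀ x y → 𝟙 (x ∧ y) ≡ 𝟙 x * 𝟙 y
𝟙-∧ true true = refl
𝟙-∧ true false = refl
𝟙-∧ false y = refl

-- x, y, z stand for a < b, b < c, a < c for three distinct points; the summands are the six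
-- orderings and the hypotheses are transitivity of < in both directions.
exactly-one-ordering : ∀ x y z → (x ≡ true → y ≡ true → z ≡ true) → (x ≡ false → y ≡ false → z ≡ false) →
  𝟙 (x ∧ y) + 𝟙 (z ∧ not y) + 𝟙 (not x ∧ z) + 𝟙 (y ∧ not z) + 𝟙 (not z ∧ x) + 𝟙 (not y ∧ not x) ≡ 1
exactly-one-ordering true true true trans-true trans-false = refl
exactly-one-ordering true true false trans-true trans-false with trans-true refl refl
... | ()
exactly-one-ordering true false true trans-true trans-false = refl
exactly-one-ordering true false false trans-true trans-false = refl
exactly-one-ordering false true true trans-true trans-false = refl
exactly-one-ordering false true false trans-true trans-false = refl
exactly-one-ordering false false true trans-true trans-false with trans-false refl refl
... | ()
exactly-one-ordering false false false trans-true trans-false = refl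

ltF-flip : ∀ {K} (x y : Fin K) → x ≢ y → ltF y x ≡ not (ltF x y)
ltF-flip x y x≢y = <ᵇ-flip (toℕ x) (toℕ y) (λ e → x≢y (FP.toℕ-injective e))

orderings : ∀ {K} → Fin K → Fin K → Fin K → ℕ
orderings a b c = 𝟙 (ltF a b ∧ ltF b c) + 𝟙 (ltF a c ∧ ltF c b) + 𝟙 (ltF b a ∧ ltF a c)
                + 𝟙 (ltF b c ∧ ltF c a) + 𝟙 (ltF c a ∧ ltF a b) + 𝟙 (ltF c b ∧ ltF b a)

orderings-distinct : ∀ {K} (a b c : Fin K) → a ≢ b → b ≢ c → a ≢ c → orderings a b c ≡ 1
orderings-distinct a b c a≢b b≢c a≢c rewrite ltF-flip a b a≢b | ltF-flip b c b≢c | ltF-flip a c a≢c =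
  exactly-one-ordering (ltF a b) (ltF b c) (ltF a c) (<ᵇ-trans (toℕ a) (toℕ b) (toℕ c))
    (λ p q → trans (sym (not-involutive (ltF a c)))
                   (cong not (trans (sym (ltF-flip a c a≢c)) (<ᵇ-trans (toℕ c) (toℕ b) (toℕ a)
                       (trans (ltF-flip b c b≢c) (cong not q)) (trans (ltF-flip a b a≢b) (cong not p))))))

orderings-diagonal : ∀ {K} (a : Fin K) → orderings a a a ≡ 0
orderings-diagonal a rewrite <ᵇ-irrefl (toℕ a) = refl

bool-ext : ∀ {x y : Bool} → (x ≡ true → y ≡ true) → (y ≡ true → x ≡ true) → x ≡ y
bool-ext {true} {true} f g = refl
bool-ext {true} {false} f g = sym (f refl)
bool-ext {false} {true} f g = g refl
bool-ext {false} {false} f g = refl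

⌊⌋-sound : ∀ {P : Set} (d : Dec P) → ⌊ d ⌋ ≡ true → P
⌊⌋-sound (yes p) _ = p

⌊⌋-complete : ∀ {P : Set} (d : Dec P) → P → ⌊ d ⌋ ≡ true
⌊⌋-complete (yes p) _ = refl
⌊⌋-complete (no ¬p) p = ⊥-elim (¬p p)

sumFin³ : ∀ {M} → (Fin M → Fin M → Fin M → ℕ) → ℕ
sumFin³ f = sumFin (λ a → sumFin (λ b → sumFin (λ c → f a b c)))

sumFin³-cong : ∀ {M} {f g : Fin M → Fin M → Fin M → ℕ} → (∀ a b c → f a b c ≡ g a b c) → sumFin³ f ≡ sumFin³ g
sumFin³-cong e = sumFin-cong (λ a → sumFin-cong (λ b → sumFin-cong (λ c → e a b c)))

sumFin³-swap₁₂ : ∀ {M} (f : Fin M → Fin M → Fin M → ℕ) → sumFin³ (λ a b c → f b a c) ≡ sumFin³ f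
sumFin³-swap₁₂ f = sumFin-swap (λ a b → sumFin (λ c → f b a c))

sumFin³-swap₂₃ : ∀ {M} (f : Fin M → Fin M → Fin M → ℕ) → sumFin³ (λ a b c → f a c b) ≡ sumFin³ f
sumFin³-swap₂₃ f = sumFin-cong (λ a → sumFin-swap (λ b c → f a c b))

sumFin³-+ : ∀ {M} (f g : Fin M → Fin M → Fin M → ℕ) → sumFin³ (λ a b c → f a b c + g a b c) ≡ sumFin³ f + sumFin³ g
sumFin³-+ f g = trans (sumFin-cong (λ a → trans (sumFin-cong (λ b → sumFin-+ (f a b) (g a b)))
                                           (sumFin-+ (λ b → sumFin (f a b)) (λ b → sumFin (g a b)))))
                 (sumFin-+ (λ a → sumFin (λ b → sumFin (f a b))) (λ a → sumFin (λ b → sumFin (g a b))))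

count-≢ : ∀ {M} (a : Fin M) → sumFin (λ b → 𝟙 (not (eqb a b))) ≡ M ∸ 1
count-≢ {M} a = trans (sym (NP.m+n∸m≡n 1 X)) (cong (_∸ 1) (trans (cong (_+ X) (sym d1)) tot))
  where
  X = sumFin (λ b → 𝟙 (not (eqb a b)))
  pt : ∀ b → 𝟙 (eqb a b) + 𝟙 (not (eqb a b)) ≡ 1
  pt b with eqb a b
  ... | true = refl
  ... | false = refl
  tot : sumFin (λ b → 𝟙 (eqb a b)) + sumFin (λ b → 𝟙 (not (eqb a b))) ≡ M
  tot = trans (sym (sumFin-+ (λ b → 𝟙 (eqb a b)) (λ b → 𝟙 (not (eqb a b))))) (trans (sumFin-cong pt) (trans (sumFin-const {M} 1) (NP.*-identityʳ M)))
  d1 : sumFin (λ b → 𝟙 (eqb a b)) ≡ 1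
  d1 = trans (sumFin-cong (λ b → sym (NP.*-identityʳ (𝟙 (eqb a b))))) (sumFin-delta′ a (λ _ → 1))

module LineCount (k : ℕ) where
  open AffineSpace k

  M : ℕ
  M = 3 ^ k

  collinearᵇ : Fin M → Fin M → Fin M → Bool
  collinearᵇ a b c = ⌊ collinear? a b c ⌋

  collinearᵇ-swap₁₂ : ∀ a b c → collinearᵇ a b c ≡ collinearᵇ b a c
  collinearᵇ-swap₁₂ a b c = bool-ext (λ e → ⌊⌋-complete (collinear? b a c) (Collinear-swap₁₂ a b c (⌊⌋-sound (collinear? a b c) e)))
                          (λ e → ⌊⌋-complete (collinear? a b c) (Collinear-swap₁₂ b a c (⌊⌋-sound (collinear? b a c) e)))

  collinearᵇ-swap₂₃ : ∀ a b c → collinearᵇ a b c ≡ collinearᵇ a c b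
  collinearᵇ-swap₂₃ a b c = bool-ext (λ e → ⌊⌋-complete (collinear? a c b) (Collinear-swap₂₃ a b c (⌊⌋-sound (collinear? a b c) e)))
                          (λ e → ⌊⌋-complete (collinear? a b c) (Collinear-swap₂₃ a c b (⌊⌋-sound (collinear? a c b) e)))

  collinearᵇ-thirdPoint : ∀ a b c → collinearᵇ a b c ≡ eqb c (thirdPoint a b)
  collinearᵇ-thirdPoint a b c = bool-ext (λ e → subst (λ x → eqb x (thirdPoint a b) ≡ true)
                                      (sym (Collinear-unique a b c (⌊⌋-sound (collinear? a b c) e))) (eqb-refl (thirdPoint a b)))
                             (λ e → ⌊⌋-complete (collinear? a b c) (subst (Collinear a b) (sym (eqb-true _ _ e)) (Collinear-thirdPoint a b)))

  isLine : Fin M → Fin M → Fin M → ℕ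
  isLine a b c = 𝟙 (ltF a b ∧ ltF b c) * 𝟙 (collinearᵇ a b c)

  #lines : ℕ
  #lines = sumFin³ isLine

  distinct-collinear-orderings : ∀ a b c → Collinear a b c → 𝟙 (not (eqb a b)) ≡ orderings a b c
  distinct-collinear-orderings a b c col with a FP.≟ b
  ... | no a≢b = trans (cong (λ e → 𝟙 (not e)) (eqb-false a b a≢b))
                       (sym (orderings-distinct a b c a≢b (λ e → c≢b (sym e)) (λ e → c≢a (sym e))))
    where
    c≢a : c ≢ a
    c≢a e = thirdPoint-≢ a b a≢b (trans (sym (Collinear-unique a b c col)) e)
    c≢b : c ≢ b
    c≢b e = thirdPoint-≢ b a (λ e′ → a≢b (sym e′)) (trans (sym (Collinear-unique b a c (Collinear-swap₁₂ a b c col))) e)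
  ... | yes refl with Collinear-degenerate a c col
  ... | refl = trans (cong (λ e → 𝟙 (not e)) (eqb-refl a)) (sym (orderings-diagonal a))

  collinearPair-orderings : ∀ a b c → 𝟙 (not (eqb a b)) * 𝟙 (collinearᵇ a b c)
    ≡ isLine a b c + isLine a c b + isLine b a c + isLine b c a + isLine c a b + isLine c b a
  collinearPair-orderings a b c =
    trans (factor (collinearᵇ a b c) (⌊⌋-sound (collinear? a b c))) distribute
    where
    factor : ∀ L → (L ≡ true → Collinear a b c) → 𝟙 (not (eqb a b)) * 𝟙 L ≡ orderings a b c * 𝟙 L
    factor false _ = trans (*-zeroʳ (𝟙 (not (eqb a b)))) (sym (*-zeroʳ (orderings a b c)))
    factor true col = cong (_* 1) (distinct-collinear-orderings a b c (col refl))
    distribute : orderings a b c * 𝟙 (collinearᵇ a b c)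
      ≡ isLine a b c + isLine a c b + isLine b a c + isLine b c a + isLine c a b + isLine c b a
    distribute = trans
      (*-distrib₆ (𝟙 (ltF a b ∧ ltF b c)) (𝟙 (ltF a c ∧ ltF c b)) (𝟙 (ltF b a ∧ ltF a c))
                  (𝟙 (ltF b c ∧ ltF c a)) (𝟙 (ltF c a ∧ ltF a b)) (𝟙 (ltF c b ∧ ltF b a)) (𝟙 (collinearᵇ a b c)))
      (sym (cong₂ _+_ (cong₂ _+_ (cong₂ _+_ (cong₂ _+_ (cong₂ _+_ refl
        (isLine-via a c b (sym (collinearᵇ-swap₂₃ a b c))))
        (isLine-via b a c (sym (collinearᵇ-swap₁₂ a b c))))
        (isLine-via b c a bca≡abc))
        (isLine-via c a b (trans (collinearᵇ-swap₁₂ c a b) (sym (collinearᵇ-swap₂₃ a b c)))))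
        (isLine-via c b a (trans (collinearᵇ-swap₁₂ c b a) bca≡abc))))
      where
      *-distrib₆ : ∀ x₁ x₂ x₃ x₄ x₅ x₆ y → (x₁ + x₂ + x₃ + x₄ + x₅ + x₆) * y
                   ≡ x₁ * y + x₂ * y + x₃ * y + x₄ * y + x₅ * y + x₆ * y
      *-distrib₆ = solve-∀
      isLine-via : ∀ x y z → collinearᵇ x y z ≡ collinearᵇ a b c →
                   isLine x y z ≡ 𝟙 (ltF x y ∧ ltF y z) * 𝟙 (collinearᵇ a b c)
      isLine-via x y z e = cong (λ L → 𝟙 (ltF x y ∧ ltF y z) * 𝟙 L) e
      bca≡abc : collinearᵇ b c a ≡ collinearᵇ a b c
      bca≡abc = trans (sym (collinearᵇ-swap₂₃ b a c)) (sym (collinearᵇ-swap₁₂ a b c))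

  #collinearPairs : ℕ
  #collinearPairs = sumFin³ (λ a b c → 𝟙 (not (eqb a b)) * 𝟙 (collinearᵇ a b c))

  #collinearPairs≡6*#lines : #collinearPairs ≡ 6 * #lines
  #collinearPairs≡6*#lines = trans (sumFin³-cong collinearPair-orderings) (trans split (lem (sumFin³ isLine)))
    where
    lem : ∀ x → x + x + x + x + x + x ≡ 6 * x
    lem = solve-∀
    p2 : sumFin³ (λ a b c → isLine a c b) ≡ sumFin³ isLine
    p2 = sumFin³-swap₂₃ isLine
    p3 : sumFin³ (λ a b c → isLine b a c) ≡ sumFin³ isLine
    p3 = sumFin³-swap₁₂ isLine
    p4 : sumFin³ (λ a b c → isLine b c a) ≡ sumFin³ isLine
    p4 = trans (sumFin³-swap₁₂ (λ a b c → isLine a c b)) p2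
    p5 : sumFin³ (λ a b c → isLine c a b) ≡ sumFin³ isLine
    p5 = trans (sumFin³-swap₂₃ (λ a b c → isLine b a c)) p3
    p6 : sumFin³ (λ a b c → isLine c b a) ≡ sumFin³ isLine
    p6 = trans (sumFin³-swap₁₂ (λ a b c → isLine c a b)) p5
    split : sumFin³ (λ a b c → isLine a b c + isLine a c b + isLine b a c + isLine b c a + isLine c a b + isLine c b a)
          ≡ sumFin³ isLine + sumFin³ isLine + sumFin³ isLine + sumFin³ isLine + sumFin³ isLine + sumFin³ isLine
    split = trans (sumFin³-+ (λ a b c → isLine a b c + isLine a c b + isLine b a c + isLine b c a + isLine c a b) (λ a b c → isLine c b a))
      (cong₂ _+_ (trans (sumFin³-+ (λ a b c → isLine a b c + isLine a c b + isLine b a c + isLine b c a) (λ a b c → isLine c a b))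
        (cong₂ _+_ (trans (sumFin³-+ (λ a b c → isLine a b c + isLine a c b + isLine b a c) (λ a b c → isLine b c a))
          (cong₂ _+_ (trans (sumFin³-+ (λ a b c → isLine a b c + isLine a c b) (λ a b c → isLine b a c))
            (cong₂ _+_ (trans (sumFin³-+ isLine (λ a b c → isLine a c b)) (cong₂ _+_ refl p2)) p3)) p4)) p5)) p6)

  #collinearPairs≡ : #collinearPairs ≡ M * (M ∸ 1)
  #collinearPairs≡ = trans (sumFin-cong (λ a → trans (sumFin-cong (λ b → inner a b))
                                          (trans (sumFin-cong (λ b → NP.*-identityʳ (𝟙 (not (eqb a b))))) (count-≢ a))))
                 (sumFin-const {M} (M ∸ 1))
    where
    inner : ∀ a b → sumFin (λ c → 𝟙 (not (eqb a b)) * 𝟙 (collinearᵇ a b c)) ≡ 𝟙 (not (eqb a b)) * 1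
    inner a b = trans (sumFin-* (𝟙 (not (eqb a b))) (λ c → 𝟙 (collinearᵇ a b c)))
      (cong (𝟙 (not (eqb a b)) *_)
        (trans (sumFin-cong (λ c → trans (cong 𝟙 (collinearᵇ-thirdPoint a b c)) (sym (NP.*-identityʳ _))))
               (sumFin-delta (thirdPoint a b) (λ _ → 1))))

  #lines≡ : #lines ≡ (M * (M ∸ 1)) / 6
  #lines≡ = sym (trans (cong (_/ 6) (trans (sym #collinearPairs≡) (trans #collinearPairs≡6*#lines (NP.*-comm 6 #lines))))
                          (m*n/n≡m #lines 6))

allFin : ∀ {m} → (Fin m → Bool) → Bool
allFin {zero} f = true
allFin {suc m} f = f zero ∧ allFin (λ r → f (suc r))

allFin-cong : ∀ {m} {f g : Fin m → Bool} → (∀ r → f r ≡ g r) → allFin f ≡ allFin g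
allFin-cong {zero} e = refl
allFin-cong {suc m} e = cong₂ _∧_ (e zero) (allFin-cong (λ r → e (suc r)))

allFin-sound : ∀ {m} (f : Fin m → Bool) → allFin f ≡ true → ∀ r → f r ≡ true
allFin-sound {suc m} f e zero with f zero
allFin-sound {suc m} f e zero | true = refl
allFin-sound {suc m} f e (suc r) with f zero
allFin-sound {suc m} f e (suc r) | true = allFin-sound (λ r → f (suc r)) e r

allFin-complete : ∀ {m} (f : Fin m → Bool) → (∀ r → f r ≡ true) → allFin f ≡ true
allFin-complete {zero} f h = refl
allFin-complete {suc m} f h rewrite h zero = allFin-complete (λ r → f (suc r)) (λ r → h (suc r))

agreesVia : ∀ {n m} → (Fin m → Fin n) → Vec (Fin 3) n → Vec (Fin 3) m → Bool
agreesVia ρ v w = allFin (λ r → eqb (lookup v (ρ r)) (lookup w r))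

3^∸-suc : ∀ n m → suc m N.≤ n → 3 ^ (n ∸ m) ≡ 3 * 3 ^ (n ∸ suc m)
3^∸-suc (suc n') m (s≤s le') = cong (3 ^_) (NP.+-∸-assoc 1 le')

count-agreesVia : ∀ n m (ρ : Fin m → Fin n) → StrictlyIncreasing ρ → (w : Vec (Fin 3) m) →
  sumFin (λ (u : Fin (3 ^ n)) → 𝟙 (agreesVia ρ (decode n u) w)) ≡ 3 ^ (n ∸ m)
count-agreesVia n zero ρ si w = trans (sumFin-const {3 ^ n} 1) (NP.*-identityʳ _)
count-agreesVia zero (suc m) ρ si w with ρ zero
... | ()
count-agreesVia (suc n) (suc m) ρ si (w0 ∷ w) = trans (sumFin-decode n (λ v → 𝟙 (agreesVia ρ v (w0 ∷ w)))) (go (ρ zero) refl)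
  where
  go : ∀ z → ρ zero ≡ z →
    sumFin (λ (x : Fin 3) → sumFin (λ (u : Fin (3 ^ n)) → 𝟙 (agreesVia ρ (x ∷ decode n u) (w0 ∷ w))))
    ≡ 3 ^ (n ∸ m)
  go zero e = trans (sumFin-cong (λ x → trans (sumFin-cong (λ u → trans (cong 𝟙 (pt x u)) (𝟙-∧ (eqb x w0) (agreesVia ρ' (decode n u) w))))
                                              (sumFin-* (𝟙 (eqb x w0)) (λ u → 𝟙 (agreesVia ρ' (decode n u) w)))))
                    (trans (sumFin-cong (λ x → cong (𝟙 (eqb x w0) *_) (count-agreesVia n m ρ' si' w)))
                           (sumFin-delta w0 (λ _ → 3 ^ (n ∸ m))))
    where
    nz : ∀ r → zero ≢ ρ (suc r)
    nz r q = FP.<-irrefl (trans e q) (si zero (suc r) (s≤s z≤n))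
    ρ' : Fin m → Fin n
    ρ' r = punchOut {i = zero} {j = ρ (suc r)} (nz r)
    sρ : ∀ r → suc (ρ' r) ≡ ρ (suc r)
    sρ r = FP.punchIn-punchOut {i = zero} {j = ρ (suc r)} (nz r)
    si' : StrictlyIncreasing ρ'
    si' i j lt = N.s≤s⁻¹ (subst₂ F._<_ (sym (sρ i)) (sym (sρ j)) (si (suc i) (suc j) (s≤s lt)))
    pt : ∀ x u → agreesVia ρ (x ∷ decode n u) (w0 ∷ w) ≡ eqb x w0 ∧ agreesVia ρ' (decode n u) w
    pt x u = cong₂ _∧_ (cong (λ y → eqb (lookup (x ∷ decode n u) y) w0) e)
                       (allFin-cong (λ r → cong (λ y → eqb (lookup (x ∷ decode n u) y) (lookup w r)) (sym (sρ r))))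
  go (suc z) e = trans (sumFin-cong (λ x → trans (sumFin-cong (λ u → cong 𝟙 (pt x u))) (count-agreesVia n (suc m) ρ'' si'' (w0 ∷ w))))
                       (trans (sumFin-const {3} (3 ^ (n ∸ suc m))) (sym expo))
    where
    nz : ∀ r → zero ≢ ρ r
    nz zero q = FP.0≢1+n (trans q e)
    nz (suc r) q = FP.<-asym (subst (λ y → y F.< ρ (suc r)) e (si zero (suc r) (s≤s z≤n)))
                             (subst (λ y → y F.< suc z) q (s≤s z≤n))
    ρ'' : Fin (suc m) → Fin n
    ρ'' r = punchOut {i = zero} {j = ρ r} (nz r)
    sρ : ∀ r → suc (ρ'' r) ≡ ρ r
    sρ r = FP.punchIn-punchOut {i = zero} {j = ρ r} (nz r)
    si'' : StrictlyIncreasing ρ''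
    si'' i j lt = N.s≤s⁻¹ (subst₂ F._<_ (sym (sρ i)) (sym (sρ j)) (si i j lt))
    pt : ∀ x u → agreesVia ρ (x ∷ decode n u) (w0 ∷ w) ≡ agreesVia ρ'' (decode n u) (w0 ∷ w)
    pt x u = allFin-cong (λ r → cong (λ y → eqb (lookup (x ∷ decode n u) y) (lookup (w0 ∷ w) r)) (sym (sρ r)))
    inj'' : ∀ {a b} → ρ'' a ≡ ρ'' b → a ≡ b
    inj'' {a} {b} q with FP.<-cmp a b
    ... | tri≈ _ r _ = r
    ... | tri< lt _ _ = ⊥-elim (FP.<-irrefl q (si'' a b lt))
    ... | tri> _ _ gt = ⊥-elim (FP.<-irrefl (sym q) (si'' b a gt))
    le : suc m N.≤ n
    le = FP.injective⇒≤ inj''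
    expo : 3 ^ (n ∸ m) ≡ 3 * 3 ^ (n ∸ suc m)
    expo = 3^∸-suc n m le

eqb≡⌊≟⌋ : ∀ {m} (p i : Fin m) → eqb p i ≡ ⌊ p FP.≟ i ⌋
eqb≡⌊≟⌋ p i with p FP.≟ i
... | yes refl = eqb-refl p
... | no ne = eqb-false p i ne

sumFin-ind3 : ∀ {N} (i j k : Fin N) → i ≢ j → j ≢ k → i ≢ k → (h : Fin N → ℕ) →
  sumFin (λ p → h p * ind3 i j k p) ≡ h i + h j + h k
sumFin-ind3 i j k ij jk ik h =
  trans (sumFin-cong pt)
  (trans (sumFin-+ (λ p → 𝟙 (eqb p i) * h p + 𝟙 (eqb p j) * h p) (λ p → 𝟙 (eqb p k) * h p))
  (cong₂ _+_ (trans (sumFin-+ (λ p → 𝟙 (eqb p i) * h p) (λ p → 𝟙 (eqb p j) * h p))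
                    (cong₂ _+_ (sumFin-delta i h) (sumFin-delta j h)))
             (sumFin-delta k h)))
  where
  pt : ∀ p → h p * ind3 i j k p ≡ 𝟙 (eqb p i) * h p + 𝟙 (eqb p j) * h p + 𝟙 (eqb p k) * h p
  pt p rewrite eqb≡⌊≟⌋ p i | eqb≡⌊≟⌋ p j | eqb≡⌊≟⌋ p k with p FP.≟ i | p FP.≟ j | p FP.≟ k
  ... | yes refl | yes refl | _ = ⊥-elim (ij refl)
  ... | yes refl | _ | yes refl = ⊥-elim (ik refl)
  ... | _ | yes refl | yes refl = ⊥-elim (jk refl)
  ... | yes refl | no _ | no _ = lem (h p)
    where lem : ∀ x → x * 1 ≡ 1 * x + 0 * x + 0 * x
          lem = solve-∀
  ... | no _ | yes refl | no _ = lem (h p)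
    where lem : ∀ x → x * 1 ≡ 0 * x + 1 * x + 0 * x
          lem = solve-∀
  ... | no _ | no _ | yes refl = lem (h p)
    where lem : ∀ x → x * 1 ≡ 0 * x + 0 * x + 1 * x
          lem = solve-∀
  ... | no _ | no _ | no _ = lem (h p)
    where lem : ∀ x → x * 0 ≡ 0 * x + 0 * x + 0 * x
          lem = solve-∀

module Projection (n t : ℕ) (σ : Fin (3 ^ n) → Vec (Fin 3) n) (bij : Bijective _≡_ _≡_ σ)
           (ρ : Fin (n ∸ t) → Fin n) (si : StrictlyIncreasing ρ) (t≤n : t N.≤ n) where

  m : ℕ
  m = n ∸ t

  open AffineSpace m public
  open LineCount m public

  coord : Fin (3 ^ n) → Fin m → Fin 3
  coord p r = lookup (σ p) (ρ r)

  -- The column of B_{n,t} at position p, as a point of AG(n − t, 3).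
  project : Fin (3 ^ n) → Fin M
  project p = encode (tabulate (coord p))

  project-coords : ∀ p r → lookup (coords (project p)) r ≡ coord p r
  project-coords p r = trans (cong (λ v → lookup v r) (decode-encode (tabulate (coord p)))) (VP.lookup∘tabulate (coord p) r)

  σinv : Vec (Fin 3) n → Fin (3 ^ n)
  σinv y = proj₁ (proj₂ bij y)

  σσinv : ∀ y → σ (σinv y) ≡ y
  σσinv y = proj₂ (proj₂ bij y) refl

  σinj : ∀ x y → σ x ≡ σ y → x ≡ y
  σinj x y e = proj₁ bij e

  fibre-size : ∀ q → countFin (λ p → eqb (project p) q) ≡ 3 ^ t
  fibre-size q =
    trans (sumFin-support e einj (λ p → 𝟙 (eqb (project p) q)) hf)
    (trans (sumFin-cong (λ u → cong 𝟙 (pt (decode n u))))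
    (trans (count-agreesVia n m ρ si (coords q)) (cong (3 ^_) (NP.m∸[m∸n]≡n t≤n))))
    where
    e : Fin (3 ^ n) → Fin (3 ^ n)
    e u = σinv (decode n u)
    einj : IsInjective e
    einj x y q = decode-injective n x y (trans (sym (σσinv _)) (trans (cong σ q) (σσinv _)))
    hf : ∀ p → (∀ i → e i ≢ p) → 𝟙 (eqb (project p) q) ≡ 0
    hf p off = ⊥-elim (off (encode (σ p)) (σinj _ _ (trans (σσinv _) (decode-encode (σ p)))))
    pt : ∀ v → eqb (project (σinv v)) q ≡ agreesVia ρ v (coords q)
    pt v = bool-ext
      (λ b → allFin-complete _ (λ r → subst (λ z → eqb (lookup v (ρ r)) z ≡ true)
          (trans (sym (trans (project-coords (σinv v) r) (cong (λ w → lookup w (ρ r)) (σσinv v))))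
                 (cong (λ z → lookup (coords z) r) (eqb-true _ _ b)))
          (eqb-refl (lookup v (ρ r)))))
      (λ b → subst (λ z → eqb (project (σinv v)) z ≡ true)
          (decode-injective m _ _ (lookup-ext _ _ (λ r → trans (project-coords (σinv v) r)
              (trans (cong (λ w → lookup w (ρ r)) (σσinv v)) (eqb-true _ _ (allFin-sound _ b r))))))
          (eqb-refl (project (σinv v))))

  InD⇒collinear : ∀ i j k → InD n t σ ρ i j k → (i F.< j) × (j F.< k) × Collinear (project i) (project j) (project k)
  InD⇒collinear i j k (ij , jk , h) = ij , jk , λ r →
    subst₂ (λ a b → lookup (coords (project k)) r ≡ third a b) (sym (project-coords i r)) (sym (project-coords j r))
      (trans (project-coords k r)
        (third-unique (coord i r) (coord j r) (coord k r)
          (trans (cong (_% 3) (sym (sumFin-ind3 i j k (FP.<⇒≢ ij) (FP.<⇒≢ jk) (FP.<⇒≢ (FP.<-trans ij jk))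
                                          (λ p → toℕ (coord p r)))))
                 (h (suc r)))))

  collinear⇒InD : ∀ i j k → i F.< j → j F.< k → Collinear (project i) (project j) (project k) → InD n t σ ρ i j k
  collinear⇒InD i j k ij jk l = ij , jk , hr
    where
    hr : ∀ r → sumFin (λ p → H n t σ ρ r p * ind3 i j k p) % 3 ≡ 0
    hr zero = cong (_% 3) (sumFin-ind3 i j k (FP.<⇒≢ ij) (FP.<⇒≢ jk) (FP.<⇒≢ (FP.<-trans ij jk)) (λ _ → 1))
    hr (suc r) = trans (cong (_% 3) (sumFin-ind3 i j k (FP.<⇒≢ ij) (FP.<⇒≢ jk) (FP.<⇒≢ (FP.<-trans ij jk))
                                          (λ p → toℕ (coord p r))))
      (subst (λ z → (toℕ (coord i r) + toℕ (coord j r) + toℕ z) % 3 ≡ 0)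
        (sym (trans (sym (project-coords k r)) (trans (l r) (cong₂ third (project-coords i r) (project-coords j r)))))
        (third-sum (coord i r) (coord j r)))

∨-swap₁₂ : ∀ x₁ x₂ x₃ x₄ x₅ x₆ → x₁ ∨ x₂ ∨ x₃ ∨ x₄ ∨ x₅ ∨ x₆ ≡ x₃ ∨ x₄ ∨ x₁ ∨ x₂ ∨ x₆ ∨ x₅
∨-swap₁₂ = solve 6 (λ x₁ x₂ x₃ x₄ x₅ x₆ →
  x₁ ⊕ (x₂ ⊕ (x₃ ⊕ (x₄ ⊕ (x₅ ⊕ x₆)))) ⊜ x₃ ⊕ (x₄ ⊕ (x₁ ⊕ (x₂ ⊕ (x₆ ⊕ x₅))))) refl

∨-swap₂₃ : ∀ x₁ x₂ x₃ x₄ x₅ x₆ → x₁ ∨ x₂ ∨ x₃ ∨ x₄ ∨ x₅ ∨ x₆ ≡ x₂ ∨ x₁ ∨ x₅ ∨ x₆ ∨ x₃ ∨ x₄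
∨-swap₂₃ = solve 6 (λ x₁ x₂ x₃ x₄ x₅ x₆ →
  x₁ ⊕ (x₂ ⊕ (x₃ ⊕ (x₄ ⊕ (x₅ ⊕ x₆)))) ⊜ x₂ ⊕ (x₁ ⊕ (x₅ ⊕ (x₆ ⊕ (x₃ ⊕ x₄))))) refl

data Rearrangement {A : Set} (a b c : A) : A → A → A → Set where
  p123 : Rearrangement a b c a b c
  p132 : Rearrangement a b c a c b
  p213 : Rearrangement a b c b a c
  p231 : Rearrangement a b c b c a
  p312 : Rearrangement a b c c a b
  p321 : Rearrangement a b c c b a

arr-sym : ∀ {A : Set} {a b c i j k : A} → Rearrangement a b c i j k → Rearrangement i j k a b c
arr-sym p123 = p123
arr-sym p132 = p132
arr-sym p213 = p213
arr-sym p231 = p312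
arr-sym p312 = p231
arr-sym p321 = p321

Tri : Set → Set
Tri A = A × A × A

t1 t2 t3 : ∀ {A : Set} → Tri A → A
t1 s = proj₁ s
t2 s = proj₁ (proj₂ s)
t3 s = proj₂ (proj₂ s)

selectOrder : ∀ {A : Set} → Bool → Bool → Bool → A → A → A → Tri A
selectOrder true true _ a b c = a , b , c
selectOrder true false true a b c = a , c , b
selectOrder true false false a b c = c , a , b
selectOrder false _ true a b c = b , a , c
selectOrder false true false a b c = b , c , a
selectOrder false false false a b c = c , b , a

sort3 : ∀ {K} → Fin K → Fin K → Fin K → Tri (Fin K)
sort3 a b c = selectOrder (ltF a b) (ltF b c) (ltF a c) a b c

sel-arr : ∀ {A : Set} x y z (a b c : A) → let s = selectOrder x y z a b c in Rearrangement a b c (t1 s) (t2 s) (t3 s)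
sel-arr true true _ a b c = p123
sel-arr true false true a b c = p132
sel-arr true false false a b c = p312
sel-arr false true true a b c = p213
sel-arr false false true a b c = p213
sel-arr false true false a b c = p231
sel-arr false false false a b c = p321

sort3-arr : ∀ {K} (a b c : Fin K) → let s = sort3 a b c in Rearrangement a b c (t1 s) (t2 s) (t3 s)
sort3-arr a b c = sel-arr (ltF a b) (ltF b c) (ltF a c) a b c

Increasing : ∀ {K} → Fin K → Fin K → Fin K → Set
Increasing i j k = (i F.< j) × (j F.< k)

Distinct : ∀ {A : Set} → A → A → A → Set
Distinct a b c = (a ≢ b) × (b ≢ c) × (a ≢ c)

ltF-true : ∀ {K} (a b : Fin K) → ltF a b ≡ true → a F.< b
ltF-true a b e = <ᵇ-sound (toℕ a) (toℕ b) e

ltF-false : ∀ {K} (a b : Fin K) → a ≢ b → ltF a b ≡ false → b F.< a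
ltF-false a b ne e with NP.<-cmp (toℕ a) (toℕ b)
... | tri< lt _ _ = ⊥-elim (true≢false (trans (sym (<ᵇ-complete _ _ lt)) e))
... | tri≈ _ eq _ = ⊥-elim (ne (FP.toℕ-injective eq))
... | tri> _ _ gt = gt

sort3-inc : ∀ {K} (a b c : Fin K) → Distinct a b c → let s = sort3 a b c in Increasing (t1 s) (t2 s) (t3 s)
sort3-inc a b c (ab , bc , ac) with ltF a b in e1 | ltF b c in e2 | ltF a c in e3
... | true | true | _ = ltF-true a b e1 , ltF-true b c e2
... | true | false | true = ltF-true a c e3 , ltF-false b c bc e2
... | true | false | false = ltF-false a c ac e3 , ltF-true a b e1
... | false | true | true = ltF-false a b ab e1 , ltF-true a c e3
... | false | false | true = ltF-false a b ab e1 , ltF-true a c e3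
... | false | true | false = ltF-true b c e2 , ltF-false a c ac e3
... | false | false | false = ltF-false b c bc e2 , ltF-false a b ab e1

OneOf : ∀ {A : Set} → A → A → A → A → Set
OneOf x a b c = (x ≡ a) ⊎ (x ≡ b) ⊎ (x ≡ c)

arr-in : ∀ {A : Set} {a b c i j k : A} → Rearrangement a b c i j k → OneOf a i j k × OneOf b i j k × OneOf c i j k
arr-in p123 = inj₁ refl , inj₂ (inj₁ refl) , inj₂ (inj₂ refl)
arr-in p132 = inj₁ refl , inj₂ (inj₂ refl) , inj₂ (inj₁ refl)
arr-in p213 = inj₂ (inj₁ refl) , inj₁ refl , inj₂ (inj₂ refl)
arr-in p231 = inj₂ (inj₂ refl) , inj₁ refl , inj₂ (inj₁ refl)
arr-in p312 = inj₂ (inj₁ refl) , inj₂ (inj₂ refl) , inj₁ refl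
arr-in p321 = inj₂ (inj₂ refl) , inj₂ (inj₁ refl) , inj₁ refl

oneOf-≥ : ∀ {K} {x i j k : Fin K} → Increasing i j k → OneOf x i j k → i F.≤ x
oneOf-≥ (ij , jk) (inj₁ refl) = NP.≤-refl
oneOf-≥ (ij , jk) (inj₂ (inj₁ refl)) = NP.<⇒≤ ij
oneOf-≥ (ij , jk) (inj₂ (inj₂ refl)) = NP.<⇒≤ (FP.<-trans ij jk)

oneOf-≤ : ∀ {K} {x i j k : Fin K} → Increasing i j k → OneOf x i j k → x F.≤ k
oneOf-≤ (ij , jk) (inj₁ refl) = NP.<⇒≤ (FP.<-trans ij jk)
oneOf-≤ (ij , jk) (inj₂ (inj₁ refl)) = NP.<⇒≤ jk
oneOf-≤ (ij , jk) (inj₂ (inj₂ refl)) = NP.≤-refl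

oneOf-trans : ∀ {A : Set} {x a b c i j k : A} → OneOf x a b c → OneOf a i j k × OneOf b i j k × OneOf c i j k → OneOf x i j k
oneOf-trans (inj₁ refl) (h , _ , _) = h
oneOf-trans (inj₂ (inj₁ refl)) (_ , h , _) = h
oneOf-trans (inj₂ (inj₂ refl)) (_ , _ , h) = h

increasing-rearrangement-unique : ∀ {K} {a b c i j k i' j' k' : Fin K} → Increasing i j k → Increasing i' j' k' →
  Rearrangement a b c i j k → Rearrangement a b c i' j' k' → (i ≡ i') × (j ≡ j') × (k ≡ k')
increasing-rearrangement-unique {i = i} {j} {k} {i'} {j'} {k'} inc inc' arr arr' = ii , jj , kk
  where
  S1 = arr-in arr
  S2 = arr-in arr'
  T1 = arr-in (arr-sym arr)
  T2 = arr-in (arr-sym arr')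
  i'∈ : OneOf i' i j k
  i'∈ = oneOf-trans (proj₁ T2) S1
  j'∈ : OneOf j' i j k
  j'∈ = oneOf-trans (proj₁ (proj₂ T2)) S1
  k'∈ : OneOf k' i j k
  k'∈ = oneOf-trans (proj₂ (proj₂ T2)) S1
  i∈ : OneOf i i' j' k'
  i∈ = oneOf-trans (proj₁ T1) S2
  k∈ : OneOf k i' j' k'
  k∈ = oneOf-trans (proj₂ (proj₂ T1)) S2
  ii : i ≡ i'
  ii = FP.≤-antisym (oneOf-≥ inc i'∈) (oneOf-≥ inc' i∈)
  kk : k ≡ k'
  kk = FP.≤-antisym (oneOf-≤ inc' k∈) (oneOf-≤ inc k'∈)
  jj : j ≡ j'
  jj with j'∈
  ... | inj₁ e = ⊥-elim (FP.<-irrefl (trans (sym ii) (sym e)) (proj₁ inc'))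
  ... | inj₂ (inj₁ e) = sym e
  ... | inj₂ (inj₂ e) = ⊥-elim (FP.<-irrefl (trans e kk) (proj₂ inc'))

mem-12 : ∀ {K} (X : Blocks K) a b c → mem X a b c ≡ mem X b a c
mem-12 X a b c = ∨-swap₁₂ (X a b c) (X a c b) (X b a c) (X b c a) (X c a b) (X c b a)

mem-23 : ∀ {K} (X : Blocks K) a b c → mem X a b c ≡ mem X a c b
mem-23 X a b c = ∨-swap₂₃ (X a b c) (X a c b) (X b a c) (X b c a) (X c a b) (X c b a)

mem-arr : ∀ {K} (X : Blocks K) {a b c i j k} → Rearrangement a b c i j k → mem X a b c ≡ mem X i j k
mem-arr X p123 = refl
mem-arr X {a} {b} {c} p132 = mem-23 X a b c
mem-arr X {a} {b} {c} p213 = mem-12 X a b c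
mem-arr X {a} {b} {c} p231 = trans (mem-12 X a b c) (mem-23 X b a c)
mem-arr X {a} {b} {c} p312 = trans (mem-23 X a b c) (mem-12 X a c b)
mem-arr X {a} {b} {c} p321 = trans (trans (mem-23 X a b c) (mem-12 X a c b)) (mem-23 X c a b)

mem-true : ∀ {K} (X : Blocks K) a b c → mem X a b c ≡ true →
  Σ (Tri (Fin K)) λ s → Rearrangement a b c (t1 s) (t2 s) (t3 s) × X (t1 s) (t2 s) (t3 s) ≡ true
mem-true X a b c e with X a b c in e1
... | true = (a , b , c) , p123 , e1
... | false with X a c b in e2
... | true = (a , c , b) , p132 , e2
... | false with X b a c in e3
... | true = (b , a , c) , p213 , e3
... | false with X b c a in e4
... | true = (b , c , a) , p231 , e4
... | false with X c a b in e5
... | true = (c , a , b) , p312 , e5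
... | false with X c b a in e6
... | true = (c , b , a) , p321 , e6

mem-intro : ∀ {K} (X : Blocks K) {a b c i j k} → Rearrangement a b c i j k → X i j k ≡ true → mem X a b c ≡ true
mem-intro X {a} {b} {c} arr e = trans (mem-arr X arr) (base e)
  where
  base : ∀ {i j k} → X i j k ≡ true → mem X i j k ≡ true
  base e rewrite e = refl

blockAt : ∀ {K} → Blocks K → Tri (Fin K) → Bool
blockAt X s = X (t1 s) (t2 s) (t3 s)

mem-sort : ∀ {K} (X : Blocks K) → Canonical X → ∀ a b c → Distinct a b c → mem X a b c ≡ blockAt X (sort3 a b c)
mem-sort X can a b c d = bool-ext to (λ e → mem-intro X (sort3-arr a b c) e)
  where
  to : mem X a b c ≡ true → blockAt X (sort3 a b c) ≡ true
  to e with mem-true X a b c e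
  ... | s , arr , xe with increasing-rearrangement-unique (can _ _ _ xe) (sort3-inc a b c d) arr (sort3-arr a b c)
  ... | q1 , q2 , q3 = subst (λ z → blockAt X z ≡ true) (cong₂ _,_ q1 (cong₂ _,_ q2 q3)) xe

arr-map : ∀ {A B : Set} (f : A → B) {a b c i j k} → Rearrangement a b c i j k → Rearrangement (f a) (f b) (f c) (f i) (f j) (f k)
arr-map f p123 = p123
arr-map f p132 = p132
arr-map f p213 = p213
arr-map f p231 = p231
arr-map f p312 = p312
arr-map f p321 = p321

dist-arr : ∀ {A : Set} {a b c i j k : A} → Rearrangement a b c i j k → Distinct a b c → Distinct i j k
dist-arr p123 (ab , bc , ac) = ab , bc , ac
dist-arr p132 (ab , bc , ac) = ac , (λ e → bc (sym e)) , ab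
dist-arr p213 (ab , bc , ac) = (λ e → ab (sym e)) , ac , bc
dist-arr p231 (ab , bc , ac) = bc , (λ e → ac (sym e)) , (λ e → ab (sym e))
dist-arr p312 (ab , bc , ac) = (λ e → ac (sym e)) , ab , (λ e → bc (sym e))
dist-arr p321 (ab , bc , ac) = (λ e → bc (sym e)) , (λ e → ab (sym e)) , (λ e → ac (sym e))

inc-dist : ∀ {K} {i j k : Fin K} → Increasing i j k → Distinct i j k
inc-dist (ij , jk) = FP.<⇒≢ ij , FP.<⇒≢ jk , FP.<⇒≢ (FP.<-trans ij jk)

arr-lift : ∀ {A B : Set} (f : A → B) {a b c : A} {P Q R : B} → Rearrangement (f a) (f b) (f c) P Q R →
  Σ (Tri A) λ s → Rearrangement a b c (t1 s) (t2 s) (t3 s) × (f (t1 s) ≡ P) × (f (t2 s) ≡ Q) × (f (t3 s) ≡ R)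
arr-lift f {a} {b} {c} p123 = (a , b , c) , p123 , refl , refl , refl
arr-lift f {a} {b} {c} p132 = (a , c , b) , p132 , refl , refl , refl
arr-lift f {a} {b} {c} p213 = (b , a , c) , p213 , refl , refl , refl
arr-lift f {a} {b} {c} p231 = (b , c , a) , p231 , refl , refl , refl
arr-lift f {a} {b} {c} p312 = (c , a , b) , p312 , refl , refl , refl
arr-lift f {a} {b} {c} p321 = (c , b , a) , p321 , refl , refl , refl

ltF-intro : ∀ {K} (a b : Fin K) → a F.< b → ltF a b ≡ true
ltF-intro a b lt = <ᵇ-complete (toℕ a) (toℕ b) lt

tri-ext : ∀ {A : Set} (s : Tri A) {x y z} → t1 s ≡ x → t2 s ≡ y → t3 s ≡ z → s ≡ (x , y , z)
tri-ext s refl refl refl = refl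

module Embedding (n t : ℕ) (σ : Fin (3 ^ n) → Vec (Fin 3) n) (bij : Bijective _≡_ _≡_ σ)
            (ρ : Fin (n ∸ t) → Fin n) (si : StrictlyIncreasing ρ) (t≤n : t N.≤ n) where

  open Projection n t σ bij ρ si t≤n public

  V T TT N3 L : ℕ
  V = 3 ^ n
  T = 3 ^ t
  TT = (T * T) * T
  N3 = (V * V) * V
  L = #lines

  Collinear-rearrange : ∀ {a b c i j k} → Rearrangement a b c i j k → Collinear a b c → Collinear i j k
  Collinear-rearrange {a} {b} {c} p123 l = l
  Collinear-rearrange {a} {b} {c} p132 l = Collinear-swap₂₃ a b c l
  Collinear-rearrange {a} {b} {c} p213 l = Collinear-swap₁₂ a b c l
  Collinear-rearrange {a} {b} {c} p231 l = Collinear-swap₂₃ b a c (Collinear-swap₁₂ a b c l)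
  Collinear-rearrange {a} {b} {c} p312 l = Collinear-swap₁₂ a c b (Collinear-swap₂₃ a b c l)
  Collinear-rearrange {a} {b} {c} p321 l = Collinear-swap₂₃ c a b (Collinear-swap₁₂ a c b (Collinear-swap₂₃ a b c l))

  abstract
    fibreEnum : (q : Fin M) → OrderedEnumeration (λ p → eqb (project p) q) T
    fibreEnum q = enumerate-of-size (λ p → eqb (project p) q) T (fibre-size q)

    fibre : Fin M → Fin T → Fin V
    fibre q = OrderedEnumeration.e (fibreEnum q)

    project-fibre : ∀ q x → project (fibre q x) ≡ q
    project-fibre q x = eqb-true _ _ (OrderedEnumeration.eP (fibreEnum q) x)

    fibre-surjective : ∀ q p → project p ≡ q → Σ (Fin T) λ x → fibre q x ≡ p
    fibre-surjective q p e = OrderedEnumeration.surj (fibreEnum q) p (subst (λ z → eqb (project p) z ≡ true) e (eqb-refl (project p)))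

    fibre-injective : ∀ q x y → fibre q x ≡ fibre q y → x ≡ y
    fibre-injective q = OrderedEnumerationProperties.inj (fibreEnum q)

    fibre-monotone : ∀ q x y → x F.< y → fibre q x F.< fibre q y
    fibre-monotone q = OrderedEnumeration.mono (fibreEnum q)

    fibre-reflects-< : ∀ q x y → fibre q x F.< fibre q y → x F.< y
    fibre-reflects-< q = OrderedEnumerationProperties.reflect (fibreEnum q)

  isLineᵇ : Fin M → Fin M → Fin M → Bool
  isLineᵇ a b c = (ltF a b ∧ ltF b c) ∧ collinearᵇ a b c

  d1 d2 d3 : Fin (M * (M * M)) → Fin M
  d1 w = proj₁ (remQuot {M} (M * M) w)
  d2 w = proj₁ (remQuot {M} M (proj₂ (remQuot {M} (M * M) w)))
  d3 w = proj₂ (remQuot {M} M (proj₂ (remQuot {M} (M * M) w)))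

  lc : Fin M → Fin M → Fin M → Fin (M * (M * M))
  lc a b c = combine a (combine b c)

  d-lc : ∀ a b c → (d1 (lc a b c) ≡ a) × (d2 (lc a b c) ≡ b) × (d3 (lc a b c) ≡ c)
  d-lc a b c = cong proj₁ e ,
               trans (cong (λ p → proj₁ (remQuot {M} M (proj₂ p))) e) (cong proj₁ e') ,
               trans (cong (λ p → proj₂ (remQuot {M} M (proj₂ p))) e) (cong proj₂ e')
    where
    e = FP.remQuot-combine {M} {M * M} a (combine b c)
    e' = FP.remQuot-combine {M} {M} b c

  lc-d : ∀ w → lc (d1 w) (d2 w) (d3 w) ≡ w
  lc-d w = trans (cong (combine (d1 w)) (FP.combine-remQuot {M} M (proj₂ (remQuot {M} (M * M) w))))
                 (FP.combine-remQuot {M} (M * M) w)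

  isLineCode : Fin (M * (M * M)) → Bool
  isLineCode w = isLineᵇ (d1 w) (d2 w) (d3 w)

  count-isLineCode : countFin isLineCode ≡ L
  count-isLineCode = trans (sumFin-combine {M} {M * M} (λ w → 𝟙 (isLineCode w)))
          (sumFin-cong (λ a → trans (sumFin-combine {M} {M} (λ w → 𝟙 (isLineCode (combine a w))))
            (sumFin-cong (λ b → sumFin-cong (λ c → pt a b c)))))
    where
    pt : ∀ a b c → 𝟙 (isLineCode (lc a b c)) ≡ isLine a b c
    pt a b c with d-lc a b c
    ... | e1 , e2 , e3 = trans (cong₃ (λ x y z → 𝟙 (isLineᵇ x y z)) e1 e2 e3) (𝟙-∧ (ltF a b ∧ ltF b c) (collinearᵇ a b c))

  abstract
    lineEnum : OrderedEnumeration isLineCode L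
    lineEnum = enumerate-of-size isLineCode L count-isLineCode

    line₁ line₂ line₃ : Fin L → Fin M
    line₁ l = d1 (OrderedEnumeration.e lineEnum l)
    line₂ l = d2 (OrderedEnumeration.e lineEnum l)
    line₃ l = d3 (OrderedEnumeration.e lineEnum l)

    ∧-l : ∀ {x y} → x ∧ y ≡ true → x ≡ true
    ∧-l {true} e = refl
    ∧-r : ∀ {x y} → x ∧ y ≡ true → y ≡ true
    ∧-r {true} e = e

    line₁<line₂ : ∀ l → line₁ l F.< line₂ l
    line₁<line₂ l = ltF-true _ _ (∧-l {ltF (line₁ l) (line₂ l)} (∧-l {ltF (line₁ l) (line₂ l) ∧ ltF (line₂ l) (line₃ l)} (OrderedEnumeration.eP lineEnum l)))
    line₂<line₃ : ∀ l → line₂ l F.< line₃ l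
    line₂<line₃ l = ltF-true _ _ (∧-r {ltF (line₁ l) (line₂ l)} (∧-l {ltF (line₁ l) (line₂ l) ∧ ltF (line₂ l) (line₃ l)} (OrderedEnumeration.eP lineEnum l)))
    line-collinear : ∀ l → Collinear (line₁ l) (line₂ l) (line₃ l)
    line-collinear l = ⌊⌋-sound (collinear? _ _ _) (∧-r {ltF (line₁ l) (line₂ l) ∧ ltF (line₂ l) (line₃ l)} (OrderedEnumeration.eP lineEnum l))
    line-distinct : ∀ l → Distinct (line₁ l) (line₂ l) (line₃ l)
    line-distinct l = inc-dist (line₁<line₂ l , line₂<line₃ l)

    line-surj : ∀ A B C → A F.< B → B F.< C → Collinear A B C →
      Σ (Fin L) λ l → (line₁ l ≡ A) × (line₂ l ≡ B) × (line₃ l ≡ C)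
    line-surj A B C ab bc lz with OrderedEnumeration.surj lineEnum (lc A B C)
          (subst₂ (λ x yz → isLineᵇ x (proj₁ yz) (proj₂ yz) ≡ true) (sym (proj₁ (d-lc A B C)))
                  (sym (cong₂ _,_ (proj₁ (proj₂ (d-lc A B C))) (proj₂ (proj₂ (d-lc A B C)))))
                  (cong₂ _∧_ (cong₂ _∧_ (ltF-intro A B ab) (ltF-intro B C bc)) (⌊⌋-complete (collinear? A B C) lz)))
    ... | l , e = l , trans (cong d1 e) (proj₁ (d-lc A B C)) , trans (cong d2 e) (proj₁ (proj₂ (d-lc A B C)))
                    , trans (cong d3 e) (proj₂ (proj₂ (d-lc A B C)))

    line-inj : ∀ l l' → line₁ l ≡ line₁ l' → line₂ l ≡ line₂ l' → line₃ l ≡ line₃ l' → l ≡ l'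
    line-inj l l' e1 e2 e3 = OrderedEnumerationProperties.inj lineEnum l l'
      (trans (sym (lc-d (OrderedEnumeration.e lineEnum l)))
        (trans (cong₂ (λ x y → lc x (proj₁ y) (proj₂ y)) e1 (cong₂ _,_ e2 e3)) (lc-d (OrderedEnumeration.e lineEnum l'))))

  tripleCode : Fin V → Fin V → Fin V → Fin N3
  tripleCode i j k = combine (combine i j) k

  tripleCode-injective : ∀ {i j k i' j' k'} → tripleCode i j k ≡ tripleCode i' j' k' → (i ≡ i') × (j ≡ j') × (k ≡ k')
  tripleCode-injective {i} {j} {k} {i'} {j'} {k'} e with FP.combine-injective (combine i j) k (combine i' j') k' e
  ... | e1 , e3 with FP.combine-injective i j i' j' e1
  ... | ea , eb = ea , eb , e3

  tripleCode′ : Tri (Fin V) → Fin N3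
  tripleCode′ s = tripleCode (t1 s) (t2 s) (t3 s)

  tripleCode′-injective : ∀ {s s'} → tripleCode′ s ≡ tripleCode′ s' → s ≡ s'
  tripleCode′-injective {s} {s'} e with tripleCode-injective e
  ... | e1 , e2 , e3 = trans (tri-ext s refl refl refl) (sym (tri-ext s' (sym e1) (sym e2) (sym e3)))

  tcode : Fin T → Fin T → Fin T → Fin TT
  tcode x y z = combine (combine x y) z

  dT : Fin TT → Tri (Fin T)
  dT w = proj₁ (remQuot {T} T (proj₁ (remQuot {T * T} T w))) ,
         proj₂ (remQuot {T} T (proj₁ (remQuot {T * T} T w))) ,
         proj₂ (remQuot {T * T} T w)

  dT-tcode : ∀ x y z → dT (tcode x y z) ≡ (x , y , z)
  dT-tcode x y z = cong₂ _,_ (trans (cong (λ p → proj₁ (remQuot {T} T (proj₁ p))) e) (cong proj₁ e'))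
                    (cong₂ _,_ (trans (cong (λ p → proj₂ (remQuot {T} T (proj₁ p))) e) (cong proj₂ e'))
                               (cong proj₂ e))
    where
    e = FP.remQuot-combine {T * T} {T} (combine x y) z
    e' = FP.remQuot-combine {T} {T} x y

  tcode-dT : ∀ w → tcode (t1 (dT w)) (t2 (dT w)) (t3 (dT w)) ≡ w
  tcode-dT w = trans (cong (λ u → combine u (proj₂ (remQuot {T * T} T w)))
                           (FP.combine-remQuot {T} T (proj₁ (remQuot {T * T} T w))))
                     (FP.combine-remQuot {T * T} T w)

  pA pB pC : Fin L → Fin T → Fin V
  pA l x = fibre (line₁ l) x
  pB l y = fibre (line₂ l) y
  pC l z = fibre (line₃ l) z

  ιF : Fin M → Fin T → Fin T → Fin T → Fin N3
  ιF q x y z = tripleCode (fibre q x) (fibre q y) (fibre q z)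

  -- A transversal block over a line is stored as a sorted triple, because blocks of a
  -- Canonical block set are increasing triples.
  sortedTransversal : Fin L → Fin T → Fin T → Fin T → Tri (Fin V)
  sortedTransversal l x y z = sort3 (pA l x) (pB l y) (pC l z)

  ιL : Fin L → Fin T → Fin T → Fin T → Fin N3
  ιL l x y z = tripleCode′ (sortedTransversal l x y z)

  ιF' : Fin M → Fin TT → Fin N3
  ιF' q w = ιF q (t1 (dT w)) (t2 (dT w)) (t3 (dT w))

  ιL' : Fin L → Fin TT → Fin N3
  ιL' l w = ιL l (t1 (dT w)) (t2 (dT w)) (t3 (dT w))

  -- The slots for blocks inside one of the M fibres, followed by the slots for transversal
  -- blocks over one of the L lines.
  ι : Fin (M * TT + L * TT) → Fin N3
  ι u = [ (λ u1 → ιF' (proj₁ (remQuot {M} TT u1)) (proj₂ (remQuot {M} TT u1)))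
        , (λ u2 → ιL' (proj₁ (remQuot {L} TT u2)) (proj₂ (remQuot {L} TT u2))) ]′ (splitAt (M * TT) u)

  uF : Fin M → Fin T → Fin T → Fin T → Fin (M * TT + L * TT)
  uF q x y z = combine q (tcode x y z) ↑ˡ (L * TT)

  uL : Fin L → Fin T → Fin T → Fin T → Fin (M * TT + L * TT)
  uL l x y z = (M * TT) ↑ʳ combine l (tcode x y z)

  ι-F : ∀ q x y z → ι (uF q x y z) ≡ ιF q x y z
  ι-F q x y z =
    trans (cong [ (λ u1 → ιF' (proj₁ (remQuot {M} TT u1)) (proj₂ (remQuot {M} TT u1)))
                , (λ u2 → ιL' (proj₁ (remQuot {L} TT u2)) (proj₂ (remQuot {L} TT u2))) ]′
                (FP.splitAt-↑ˡ (M * TT) (combine q (tcode x y z)) (L * TT)))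
    (trans (cong (λ p → ιF' (proj₁ p) (proj₂ p)) (FP.remQuot-combine {M} {TT} q (tcode x y z)))
           (cong (λ s → ιF q (t1 s) (t2 s) (t3 s)) (dT-tcode x y z)))

  ι-L : ∀ l x y z → ι (uL l x y z) ≡ ιL l x y z
  ι-L l x y z =
    trans (cong [ (λ u1 → ιF' (proj₁ (remQuot {M} TT u1)) (proj₂ (remQuot {M} TT u1)))
                , (λ u2 → ιL' (proj₁ (remQuot {L} TT u2)) (proj₂ (remQuot {L} TT u2))) ]′
                (FP.splitAt-↑ʳ (M * TT) (L * TT) (combine l (tcode x y z))))
    (trans (cong (λ p → ιL' (proj₁ p) (proj₂ p)) (FP.remQuot-combine {L} {TT} l (tcode x y z)))
           (cong (λ s → ιL l (t1 s) (t2 s) (t3 s)) (dT-tcode x y z)))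

  ViewF : Fin (M * TT + L * TT) → Set
  ViewF u = Σ (Fin M) λ q → Σ (Fin T) λ x → Σ (Fin T) λ y → Σ (Fin T) λ z → u ≡ uF q x y z
  ViewL : Fin (M * TT + L * TT) → Set
  ViewL u = Σ (Fin L) λ l → Σ (Fin T) λ x → Σ (Fin T) λ y → Σ (Fin T) λ z → u ≡ uL l x y z

  ι-view : ∀ u → ViewF u ⊎ ViewL u
  ι-view u with splitAt (M * TT) u in eq
  ... | inj₁ u1 = inj₁ (q , t1 (dT w) , t2 (dT w) , t3 (dT w) ,
          trans (sym (trans (cong (F.join (M * TT) (L * TT)) (sym eq)) (FP.join-splitAt (M * TT) (L * TT) u)))
                (cong (_↑ˡ (L * TT)) (trans (sym (FP.combine-remQuot {M} TT u1)) (cong (combine q) (sym (tcode-dT w))))))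
    where
    q = proj₁ (remQuot {M} TT u1)
    w = proj₂ (remQuot {M} TT u1)
  ... | inj₂ u2 = inj₂ (l , t1 (dT w) , t2 (dT w) , t3 (dT w) ,
          trans (sym (trans (cong (F.join (M * TT) (L * TT)) (sym eq)) (FP.join-splitAt (M * TT) (L * TT) u)))
                (cong ((M * TT) ↑ʳ_) (trans (sym (FP.combine-remQuot {L} TT u2)) (cong (combine l) (sym (tcode-dT w))))))
    where
    l = proj₁ (remQuot {L} TT u2)
    w = proj₂ (remQuot {L} TT u2)

  arr-subst : ∀ {A : Set} {a b c a' b' c' i j k : A} → a ≡ a' → b ≡ b' → c ≡ c' → Rearrangement a b c i j k → Rearrangement a' b' c' i j k
  arr-subst refl refl refl r = r


  transversal-distinct : ∀ l x y z → Distinct (pA l x) (pB l y) (pC l z)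
  transversal-distinct l x y z with line-distinct l
  ... | ab , bc , ac = (λ e → ab (trans (sym (project-fibre _ x)) (trans (cong project e) (project-fibre _ y))))
                     , (λ e → bc (trans (sym (project-fibre _ y)) (trans (cong project e) (project-fibre _ z))))
                     , (λ e → ac (trans (sym (project-fibre _ x)) (trans (cong project e) (project-fibre _ z))))

  sortedTransversal-rearranges : ∀ l x y z → let S = sortedTransversal l x y z in Rearrangement (pA l x) (pB l y) (pC l z) (t1 S) (t2 S) (t3 S)
  sortedTransversal-rearranges l x y z = sort3-arr (pA l x) (pB l y) (pC l z)

  sortedTransversal-increasing : ∀ l x y z → let S = sortedTransversal l x y z in Increasing (t1 S) (t2 S) (t3 S)
  sortedTransversal-increasing l x y z = sort3-inc (pA l x) (pB l y) (pC l z) (transversal-distinct l x y z)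

  sortedTransversal-projects : ∀ l x y z → let S = sortedTransversal l x y z in Rearrangement (line₁ l) (line₂ l) (line₃ l) (project (t1 S)) (project (t2 S)) (project (t3 S))
  sortedTransversal-projects l x y z = arr-subst (project-fibre _ x) (project-fibre _ y) (project-fibre _ z) (arr-map project (sortedTransversal-rearranges l x y z))

  sortedTransversal-distinct-fibres : ∀ l x y z → let S = sortedTransversal l x y z in Distinct (project (t1 S)) (project (t2 S)) (project (t3 S))
  sortedTransversal-distinct-fibres l x y z = dist-arr (sortedTransversal-projects l x y z) (line-distinct l)

  pick1 : ∀ {p a b c} → OneOf p a b c → project p ≡ project a → Distinct (project a) (project b) (project c) → p ≡ a
  pick1 (inj₁ e) _ _ = e
  pick1 (inj₂ (inj₁ refl)) f (ab , bc , ac) = ⊥-elim (ab (sym f))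
  pick1 (inj₂ (inj₂ refl)) f (ab , bc , ac) = ⊥-elim (ac (sym f))

  pick2 : ∀ {p a b c} → OneOf p a b c → project p ≡ project b → Distinct (project a) (project b) (project c) → p ≡ b
  pick2 (inj₁ refl) f (ab , bc , ac) = ⊥-elim (ab f)
  pick2 (inj₂ (inj₁ e)) _ _ = e
  pick2 (inj₂ (inj₂ refl)) f (ab , bc , ac) = ⊥-elim (bc (sym f))

  pick3 : ∀ {p a b c} → OneOf p a b c → project p ≡ project c → Distinct (project a) (project b) (project c) → p ≡ c
  pick3 (inj₁ refl) f (ab , bc , ac) = ⊥-elim (ac f)
  pick3 (inj₂ (inj₁ refl)) f (ab , bc , ac) = ⊥-elim (bc f)
  pick3 (inj₂ (inj₂ e)) _ _ = e

  FF-inj : ∀ q x y z q' x' y' z' → ιF q x y z ≡ ιF q' x' y' z' → uF q x y z ≡ uF q' x' y' z'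
  FF-inj q x y z q' x' y' z' e with tripleCode-injective e
  ... | e1 , e2 , e3 with trans (sym (project-fibre q x)) (trans (cong project e1) (project-fibre q' x'))
  ... | refl = cong₃ (uF q) (fibre-injective q x x' e1) (fibre-injective q y y' e2) (fibre-injective q z z' e3)

  FL-absurd : ∀ q x y z l x' y' z' → ιF q x y z ≡ ιL l x' y' z' → ⊥
  FL-absurd q x y z l x' y' z' e with tripleCode-injective e
  ... | e1 , e2 , e3 = proj₁ (sortedTransversal-distinct-fibres l x' y' z')
          (trans (cong project (sym e1)) (trans (project-fibre q x) (trans (sym (project-fibre q y)) (cong project e2))))

  LL-inj : ∀ l x y z l' x' y' z' → ιL l x y z ≡ ιL l' x' y' z' → uL l x y z ≡ uL l' x' y' z'
  LL-inj l x y z l' x' y' z' e = go (line-inj l l' (proj₁ U) (proj₁ (proj₂ U)) (proj₂ (proj₂ U)))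
    where
    SS : sortedTransversal l x y z ≡ sortedTransversal l' x' y' z'
    SS = tripleCode′-injective e
    arr2 : let S = sortedTransversal l x y z in Rearrangement (project (t1 S)) (project (t2 S)) (project (t3 S)) (line₁ l') (line₂ l') (line₃ l')
    arr2 = subst (λ s → Rearrangement (project (t1 s)) (project (t2 s)) (project (t3 s)) (line₁ l') (line₂ l') (line₃ l')) (sym SS)
                 (arr-sym (sortedTransversal-projects l' x' y' z'))
    U = increasing-rearrangement-unique (line₁<line₂ l , line₂<line₃ l) (line₁<line₂ l' , line₂<line₃ l') (arr-sym (sortedTransversal-projects l x y z)) arr2
    go : l ≡ l' → uL l x y z ≡ uL l' x' y' z'
    go refl = cong₃ (uL l) (fibre-injective _ x x' (pick1 inA (trans (project-fibre _ x) (sym (project-fibre _ x'))) D'))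
                           (fibre-injective _ y y' (pick2 inB (trans (project-fibre _ y) (sym (project-fibre _ y'))) D'))
                           (fibre-injective _ z z' (pick3 inC (trans (project-fibre _ z) (sym (project-fibre _ z'))) D'))
      where
      D' : Distinct (project (pA l x')) (project (pB l y')) (project (pC l z'))
      D' = subst₃ Distinct (sym (project-fibre _ x')) (sym (project-fibre _ y')) (sym (project-fibre _ z')) (line-distinct l)
      I1 = arr-in (sortedTransversal-rearranges l x y z)
      I2 = arr-in (arr-sym (sortedTransversal-rearranges l x' y' z'))
      tr : ∀ {p} → OneOf p (t1 (sortedTransversal l x y z)) (t2 (sortedTransversal l x y z)) (t3 (sortedTransversal l x y z)) → OneOf p (pA l x') (pB l y') (pC l z')
      tr {p} h = oneOf-trans (subst (λ s → OneOf p (t1 s) (t2 s) (t3 s)) SS h) I2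
      inA = tr (proj₁ I1)
      inB = tr (proj₁ (proj₂ I1))
      inC = tr (proj₂ (proj₂ I1))

  injV : ∀ u u' → ViewF u ⊎ ViewL u → ViewF u' ⊎ ViewL u' → ι u ≡ ι u' → u ≡ u'
  injV _ _ (inj₁ (q , x , y , z , refl)) (inj₁ (q' , x' , y' , z' , refl)) e =
        FF-inj q x y z q' x' y' z' (trans (sym (ι-F q x y z)) (trans e (ι-F q' x' y' z')))
  injV _ _ (inj₁ (q , x , y , z , refl)) (inj₂ (l' , x' , y' , z' , refl)) e =
        ⊥-elim (FL-absurd q x y z l' x' y' z' (trans (sym (ι-F q x y z)) (trans e (ι-L l' x' y' z'))))
  injV _ _ (inj₂ (l , x , y , z , refl)) (inj₁ (q' , x' , y' , z' , refl)) e =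
        ⊥-elim (FL-absurd q' x' y' z' l x y z (sym (trans (sym (ι-L l x y z)) (trans e (ι-F q' x' y' z')))))
  injV _ _ (inj₂ (l , x , y , z , refl)) (inj₂ (l' , x' , y' , z' , refl)) e =
        LL-inj l x y z l' x' y' z' (trans (sym (ι-L l x y z)) (trans e (ι-L l' x' y' z')))

  ι-inj : IsInjective ι
  ι-inj u u' e = injV u u' (ι-view u) (ι-view u') e

  collinear-in-image : ∀ i j k → Increasing i j k → Collinear (project i) (project j) (project k) → Σ _ λ u → ι u ≡ tripleCode i j k
  collinear-in-image i j k inc lz with project i FP.≟ project j
  ... | yes e = uF q (proj₁ X) (proj₁ Y) (proj₁ Z) ,
                trans (ι-F q _ _ _) (cong₃ tripleCode (proj₂ X) (proj₂ Y) (proj₂ Z))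
    where
    q = project i
    fk : project k ≡ project i
    fk = Collinear-degenerate (project i) (project k) (subst (λ z → Collinear (project i) z (project k)) (sym e) lz)
    X = fibre-surjective q i refl
    Y = fibre-surjective q j (sym e)
    Z = fibre-surjective q k fk
  ... | no ne = uL l (proj₁ X) (proj₁ Y) (proj₁ Z) ,
                trans (ι-L l _ _ _) (trans (cong tripleCode′ (cong₃ sort3 (proj₂ X) (proj₂ Y) (proj₂ Z)))
                  (cong₃ tripleCode (proj₁ U) (proj₁ (proj₂ U)) (proj₂ (proj₂ U))))
    where
    fki : project k ≢ project i
    fki e = ne (sym (Collinear-degenerate (project i) (project j) (Collinear-swap₂₃ (project i) (project j) (project i) (subst (Collinear (project i) (project j)) e lz))))
    fkj : project k ≢ project j
    fkj e = ne (Collinear-degenerate (project j) (project i) (Collinear-swap₂₃ (project j) (project i) (project j)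
                  (subst (Collinear (project j) (project i)) e (Collinear-swap₁₂ (project i) (project j) (project k) lz))))
    DF : Distinct (project i) (project j) (project k)
    DF = ne , (λ e → fkj (sym e)) , (λ e → fki (sym e))
    Sf = sort3 (project i) (project j) (project k)
    arrF = sort3-arr (project i) (project j) (project k)
    incF = sort3-inc (project i) (project j) (project k) DF
    LI = line-surj (t1 Sf) (t2 Sf) (t3 Sf) (proj₁ incF) (proj₂ incF) (Collinear-rearrange arrF lz)
    l = proj₁ LI
    lifted = arr-lift project arrF
    s = proj₁ lifted
    arrP = proj₁ (proj₂ lifted)
    X = fibre-surjective (line₁ l) (t1 s) (trans (proj₁ (proj₂ (proj₂ lifted))) (sym (proj₁ (proj₂ LI))))
    Y = fibre-surjective (line₂ l) (t2 s) (trans (proj₁ (proj₂ (proj₂ (proj₂ lifted)))) (sym (proj₁ (proj₂ (proj₂ LI)))))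
    Z = fibre-surjective (line₃ l) (t3 s) (trans (proj₂ (proj₂ (proj₂ (proj₂ lifted)))) (sym (proj₂ (proj₂ (proj₂ LI)))))
    D : Distinct (t1 s) (t2 s) (t3 s)
    D = dist-arr arrP (inc-dist inc)
    U = increasing-rearrangement-unique (sort3-inc (t1 s) (t2 s) (t3 s) D) inc (sort3-arr (t1 s) (t2 s) (t3 s)) (arr-sym arrP)

module Correspondence (n t : ℕ) (σ : Fin (3 ^ n) → Vec (Fin 3) n) (bij : Bijective _≡_ _≡_ σ)
            (ρ : Fin (n ∸ t) → Fin n) (si : StrictlyIncreasing ρ) (t≤n : t N.≤ n) where

  open Embedding n t σ bij ρ si t≤n public

  InD-Blocks : Blocks V → Set
  InD-Blocks X = ∀ i j k → X i j k ≡ true → Increasing i j k × Collinear (project i) (project j) (project k)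

  fibreSystem : Blocks V → Fin M → Blocks T
  fibreSystem X q x y z = X (fibre q x) (fibre q y) (fibre q z)

  lineDesign : Blocks V → Fin L → Blocks T
  lineDesign X l x y z = blockAt X (sortedTransversal l x y z)

  SubD⇒InD-Blocks : ∀ X → SubD n t σ ρ X → InD-Blocks X
  SubD⇒InD-Blocks X sd i j k e with InD⇒collinear i j k (sd i j k e)
  ... | ij , jk , lz = (ij , jk) , lz

  InD-Blocks⇒SubD : ∀ X → InD-Blocks X → SubD n t σ ρ X
  InD-Blocks⇒SubD X gd i j k e with gd i j k e
  ... | (ij , jk) , lz = collinear⇒InD i j k ij jk lz

  InD-Blocks⇒Canonical : ∀ X → InD-Blocks X → Canonical X
  InD-Blocks⇒Canonical X gd i j k e = proj₁ (gd i j k e)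

  mem⇒collinear : ∀ X → InD-Blocks X → ∀ a b c → mem X a b c ≡ true → Distinct a b c × Collinear (project a) (project b) (project c)
  mem⇒collinear X gd a b c e with mem-true X a b c e
  ... | s , arr , xe with gd _ _ _ xe
  ... | inc , lz = dist-arr (arr-sym arr) (inc-dist inc) , Collinear-rearrange (arr-map project (arr-sym arr)) lz

  collinear-third-unique : ∀ A B C → Collinear A B C → ∀ D → Collinear A B D → D ≡ C
  collinear-third-unique A B C l D h = trans (Collinear-unique A B D h) (sym (Collinear-unique A B C l))

  count-mem-within : ∀ X → IsSTS X → InD-Blocks X → ∀ a b → a ≢ b → (Q : Fin M) →
    (∀ c → mem X a b c ≡ true → project c ≡ Q) → countFin (λ z → mem X a b (fibre Q z)) ≡ 1
  count-mem-within X sts gd a b ne Q hQ =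
    trans (sym (sumFin-support (fibre Q) (fibre-injective Q) (λ c → 𝟙 (mem X a b c)) hf)) (proj₂ sts a b ne)
    where
    hf : ∀ c → (∀ i → fibre Q i ≢ c) → 𝟙 (mem X a b c) ≡ 0
    hf c off with mem X a b c in e
    ... | true = ⊥-elim (off (proj₁ (fibre-surjective Q c (hQ c e))) (proj₂ (fibre-surjective Q c (hQ c e))))
    ... | false = refl

  fibreSystem-isSTS : ∀ X → IsSTS X → InD-Blocks X → ∀ q → IsSTS (fibreSystem X q)
  fibreSystem-isSTS X sts gd q = can , cnt
    where
    can : Canonical (fibreSystem X q)
    can x y z e with gd _ _ _ e
    ... | (ij , jk) , _ = fibre-reflects-< q x y ij , fibre-reflects-< q y z jk
    cnt : ∀ x y → x ≢ y → countFin (mem (fibreSystem X q) x y) ≡ 1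
    cnt x y ne = count-mem-within X sts gd (fibre q x) (fibre q y) (λ e → ne (fibre-injective q x y e)) q
      (λ c m → Collinear-degenerate q (project c) (subst₂ (λ u v → Collinear u v (project c)) (project-fibre q x) (project-fibre q y) (proj₂ (mem⇒collinear X gd _ _ c m))))

  lineDesign-isTD : ∀ X → IsSTS X → InD-Blocks X → ∀ l → IsTD (lineDesign X l)
  lineDesign-isTD X sts gd l = third-free , second-free , first-free
    where
    can = InD-Blocks⇒Canonical X gd
    lineDesign-mem : ∀ x y z → lineDesign X l x y z ≡ mem X (pA l x) (pB l y) (pC l z)
    lineDesign-mem x y z = sym (mem-sort X can _ _ _ (transversal-distinct l x y z))
    images-collinear : ∀ {a b c : Fin V} {A B : Fin M} → project a ≡ A → project b ≡ B → mem X a b c ≡ true → Collinear A B (project c)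
    images-collinear {a} {b} {c} ea eb m = subst₂ (λ u v → Collinear u v (project c)) ea eb (proj₂ (mem⇒collinear X gd a b c m))
    D = transversal-distinct l
    third-free : ∀ x y → countFin (λ z → lineDesign X l x y z) ≡ 1
    third-free x y = trans (sumFin-cong (λ z → cong 𝟙 (lineDesign-mem x y z)))
      (count-mem-within X sts gd (pA l x) (pB l y) (proj₁ (D x y x)) (line₃ l)
        (λ c m → collinear-third-unique _ _ _ (line-collinear l) (project c) (images-collinear (project-fibre _ x) (project-fibre _ y) m)))
    second-free : ∀ x z → countFin (λ y → lineDesign X l x y z) ≡ 1
    second-free x z = trans (sumFin-cong (λ y → cong 𝟙 (trans (lineDesign-mem x y z) (mem-23 X _ _ _))))
      (count-mem-within X sts gd (pA l x) (pC l z) (proj₂ (proj₂ (D x x z))) (line₂ l)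
        (λ c m → collinear-third-unique _ _ _ (Collinear-swap₂₃ _ _ _ (line-collinear l)) (project c) (images-collinear (project-fibre _ x) (project-fibre _ z) m)))
    first-free : ∀ y z → countFin (λ x → lineDesign X l x y z) ≡ 1
    first-free y z = trans (sumFin-cong (λ x → cong 𝟙 (trans (lineDesign-mem x y z) (mem-arr X p231))))
      (count-mem-within X sts gd (pB l y) (pC l z) (proj₁ (proj₂ (D y y z))) (line₁ l)
        (λ c m → collinear-third-unique _ _ _ (Collinear-rearrange p231 (line-collinear l)) (project c) (images-collinear (project-fibre _ y) (project-fibre _ z) m)))

  module Gluing (X : Blocks V) (sts : ∀ q → IsSTS (fibreSystem X q)) (td : ∀ l → IsTD (lineDesign X l))
             (img : ∀ i j k → X i j k ≡ true → Σ _ λ u → ι u ≡ tripleCode i j k) where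

    good : InD-Blocks X
    good i j k e = goodU (proj₁ (img i j k e)) (ι-view (proj₁ (img i j k e))) (proj₂ (img i j k e))
      where
      goodU : ∀ u → ViewF u ⊎ ViewL u → ι u ≡ tripleCode i j k → Increasing i j k × Collinear (project i) (project j) (project k)
      goodU u (inj₁ (q , x , y , z , refl)) eu = inc , lz
        where
        cs = tripleCode-injective (trans (sym (ι-F q x y z)) eu)
        e1 = proj₁ cs
        e2 = proj₁ (proj₂ cs)
        e3 = proj₂ (proj₂ cs)
        xe : fibreSystem X q x y z ≡ true
        xe = subst₃ (λ a b c → X a b c ≡ true) (sym e1) (sym e2) (sym e3) e
        inc : Increasing i j k
        inc = subst₃ Increasing e1 e2 e3 (fibre-monotone q x y (proj₁ (proj₁ (sts q) x y z xe)) , fibre-monotone q y z (proj₂ (proj₁ (sts q) x y z xe)))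
        lz : Collinear (project i) (project j) (project k)
        lz = subst₃ (λ a b c → Collinear (project a) (project b) (project c)) e1 e2 e3
               (subst₃ Collinear (sym (project-fibre q x)) (sym (project-fibre q y)) (sym (project-fibre q z)) (Collinear-refl q))
      goodU u (inj₂ (l , x , y , z , refl)) eu =
        subst (λ s → Increasing (t1 s) (t2 s) (t3 s)) SS (sortedTransversal-increasing l x y z) ,
        subst (λ s → Collinear (project (t1 s)) (project (t2 s)) (project (t3 s))) SS (Collinear-rearrange (sortedTransversal-projects l x y z) (line-collinear l))
        where
        SS = tripleCode′-injective {sortedTransversal l x y z} {i , j , k} (trans (sym (ι-L l x y z)) eu)

    can : Canonical X
    can = InD-Blocks⇒Canonical X good

    count-mem-across-line : ∀ a b Q l (A B C : Fin M) → Rearrangement (project a) (project b) Q A B C → line₁ l ≡ A → line₂ l ≡ B → line₃ l ≡ C →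
      countFin (λ z → mem X a b (fibre Q z)) ≡ 1
    count-mem-across-line a b Q l A B C p123 eA eB refl =
      trans (sumFin-cong (λ z → cong 𝟙 (trans (cong₂ (λ u v → mem X u v (pC l z)) (sym (proj₂ XA)) (sym (proj₂ YB)))
                                               (mem-sort X can _ _ _ (transversal-distinct l _ _ z)))))
            (proj₁ (td l) (proj₁ XA) (proj₁ YB))
      where
      XA = fibre-surjective (line₁ l) a (sym eA)
      YB = fibre-surjective (line₂ l) b (sym eB)
    count-mem-across-line a b Q l A B C p213 eA eB refl =
      trans (sumFin-cong (λ z → cong 𝟙 (trans (mem-12 X a b (pC l z))
              (trans (cong₂ (λ u v → mem X u v (pC l z)) (sym (proj₂ XA)) (sym (proj₂ YB)))
                     (mem-sort X can _ _ _ (transversal-distinct l _ _ z))))))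
            (proj₁ (td l) (proj₁ XA) (proj₁ YB))
      where
      XA = fibre-surjective (line₁ l) b (sym eA)
      YB = fibre-surjective (line₂ l) a (sym eB)
    count-mem-across-line a b Q l A B C p132 eA refl eC =
      trans (sumFin-cong (λ y → cong 𝟙 (trans (mem-23 X a b (pB l y))
              (trans (cong₂ (λ u v → mem X u (pB l y) v) (sym (proj₂ XA)) (sym (proj₂ ZC)))
                     (mem-sort X can _ _ _ (transversal-distinct l _ y _))))))
            (proj₁ (proj₂ (td l)) (proj₁ XA) (proj₁ ZC))
      where
      XA = fibre-surjective (line₁ l) a (sym eA)
      ZC = fibre-surjective (line₃ l) b (sym eC)
    count-mem-across-line a b Q l A B C p231 eA refl eC =
      trans (sumFin-cong (λ y → cong 𝟙 (trans (mem-arr X p231)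
              (trans (cong₂ (λ u v → mem X u (pB l y) v) (sym (proj₂ XA)) (sym (proj₂ ZC)))
                     (mem-sort X can _ _ _ (transversal-distinct l _ y _))))))
            (proj₁ (proj₂ (td l)) (proj₁ XA) (proj₁ ZC))
      where
      XA = fibre-surjective (line₁ l) b (sym eA)
      ZC = fibre-surjective (line₃ l) a (sym eC)
    count-mem-across-line a b Q l A B C p312 refl eB eC =
      trans (sumFin-cong (λ x → cong 𝟙 (trans (mem-arr X p312)
              (trans (cong₂ (λ u v → mem X (pA l x) u v) (sym (proj₂ YB)) (sym (proj₂ ZC)))
                     (mem-sort X can _ _ _ (transversal-distinct l x _ _))))))
            (proj₂ (proj₂ (td l)) (proj₁ YB) (proj₁ ZC))
      where
      YB = fibre-surjective (line₂ l) a (sym eB)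
      ZC = fibre-surjective (line₃ l) b (sym eC)
    count-mem-across-line a b Q l A B C p321 refl eB eC =
      trans (sumFin-cong (λ x → cong 𝟙 (trans (mem-arr X p321)
              (trans (cong₂ (λ u v → mem X (pA l x) u v) (sym (proj₂ YB)) (sym (proj₂ ZC)))
                     (mem-sort X can _ _ _ (transversal-distinct l x _ _))))))
            (proj₂ (proj₂ (td l)) (proj₁ YB) (proj₁ ZC))
      where
      YB = fibre-surjective (line₂ l) b (sym eB)
      ZC = fibre-surjective (line₃ l) a (sym eC)

    cnt : ∀ a b → a ≢ b → countFin (mem X a b) ≡ 1
    cnt a b ne with project a FP.≟ project b
    ... | yes e = trans (sumFin-support (fibre q) (fibre-injective q) (λ c → 𝟙 (mem X a b c)) hf)
                        (trans (sumFin-cong pt) (proj₂ (sts q) (proj₁ X0) (proj₁ Y0) nxy))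
      where
      q = project a
      hf : ∀ c → (∀ i → fibre q i ≢ c) → 𝟙 (mem X a b c) ≡ 0
      hf c off with mem X a b c in em
      ... | false = refl
      ... | true = ⊥-elim (off (proj₁ W0) (proj₂ W0))
        where
        fc : project c ≡ q
        fc = Collinear-degenerate q (project c) (subst (λ v → Collinear q v (project c)) (sym e) (proj₂ (mem⇒collinear X good a b c em)))
        W0 = fibre-surjective q c fc
      X0 = fibre-surjective q a refl
      Y0 = fibre-surjective q b (sym e)
      pt : ∀ z → 𝟙 (mem X a b (fibre q z)) ≡ 𝟙 (mem (fibreSystem X q) (proj₁ X0) (proj₁ Y0) z)
      pt z = cong 𝟙 (cong₂ (λ u v → mem X u v (fibre q z)) (sym (proj₂ X0)) (sym (proj₂ Y0)))
      nxy : proj₁ X0 ≢ proj₁ Y0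
      nxy e' = ne (trans (sym (proj₂ X0)) (trans (cong (fibre q) e') (proj₂ Y0)))
    ... | no ne' = trans (sumFin-support (fibre C') (fibre-injective C') (λ c → 𝟙 (mem X a b c)) hf)
                         (count-mem-across-line a b C' l _ _ _ arr (proj₁ (proj₂ LI)) (proj₁ (proj₂ (proj₂ LI))) (proj₂ (proj₂ (proj₂ LI))))
      where
      C' = thirdPoint (project a) (project b)
      hf : ∀ c → (∀ i → fibre C' i ≢ c) → 𝟙 (mem X a b c) ≡ 0
      hf c off with mem X a b c in em
      ... | false = refl
      ... | true = ⊥-elim (off (proj₁ W0) (proj₂ W0))
        where
        W0 = fibre-surjective C' c (Collinear-unique (project a) (project b) (project c) (proj₂ (mem⇒collinear X good a b c em)))
      DF : Distinct (project a) (project b) C'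
      DF = ne' ,
           (λ e → thirdPoint-≢ (project b) (project a) (λ e' → ne' (sym e'))
                    (trans (sym (Collinear-unique (project b) (project a) C' (Collinear-swap₁₂ _ _ _ (Collinear-thirdPoint (project a) (project b))))) (sym e))) ,
           (λ e → thirdPoint-≢ (project a) (project b) ne' (sym e))
      Sf = sort3 (project a) (project b) C'
      arr = sort3-arr (project a) (project b) C'
      inc = sort3-inc (project a) (project b) C' DF
      LI = line-surj (t1 Sf) (t2 Sf) (t3 Sf) (proj₁ inc) (proj₂ inc) (Collinear-rearrange arr (Collinear-thirdPoint (project a) (project b)))
      l = proj₁ LI

    glued-isSTS : IsSTS X
    glued-isSTS = can , cnt

    glued-SubD : SubD n t σ ρ X
    glued-SubD = InD-Blocks⇒SubD X good

dec-eq : ∀ {P Q : Set} (p : Dec P) (q : Dec Q) → (P → Q) → (Q → P) → ⌊ p ⌋ ≡ ⌊ q ⌋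
dec-eq (yes p) (yes q) f g = refl
dec-eq (yes p) (no nq) f g = ⊥-elim (nq (f p))
dec-eq (no np) (yes q) f g = ⊥-elim (np (g q))
dec-eq (no np) (no nq) f g = refl

Eq3 : ∀ {v} → Blocks v → Blocks v → Set
Eq3 X X' = ∀ i j k → X i j k ≡ X' i j k

mem-cong : ∀ {v} {X X' : Blocks v} → Eq3 X X' → ∀ a b c → mem X a b c ≡ mem X' a b c
mem-cong e a b c rewrite e a b c | e a c b | e b a c | e b c a | e c a b | e c b a = refl

sts-tr : ∀ {v} {X X' : Blocks v} → Eq3 X X' → IsSTS X → IsSTS X'
sts-tr {X = X} {X'} e (can , cnt) =
  (λ i j k h → can i j k (trans (e i j k) h)) ,
  (λ a b ne → trans (sumFin-cong (λ c → cong 𝟙 (sym (mem-cong e a b c)))) (cnt a b ne))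

td-tr : ∀ {v} {X X' : Blocks v} → Eq3 X X' → IsTD X → IsTD X'
td-tr e (c1 , c2 , c3) =
  (λ a b → trans (sumFin-cong (λ c → cong 𝟙 (sym (e a b c)))) (c1 a b)) ,
  (λ a c → trans (sumFin-cong (λ b → cong 𝟙 (sym (e a b c)))) (c2 a c)) ,
  (λ b c → trans (sumFin-cong (λ a → cong 𝟙 (sym (e a b c)))) (c3 b c))

sym3 : ∀ {v} {X X' : Blocks v} → Eq3 X X' → Eq3 X' X
sym3 e i j k = sym (e i j k)

respSTS : ∀ {v} → RespectsPointwise₃ {v} (λ X → 𝟙 ⌊ isSTS? X ⌋)
respSTS X X' e = cong 𝟙 (dec-eq (isSTS? X) (isSTS? X') (sts-tr e) (sts-tr (sym3 e)))

respTD : ∀ {v} → RespectsPointwise₃ {v} (λ X → 𝟙 ⌊ isTD? X ⌋)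
respTD X X' e = cong 𝟙 (dec-eq (isTD? X) (isTD? X') (td-tr e) (td-tr (sym3 e)))

subD-tr : ∀ n t σ ρ {X X' : Blocks (3 ^ n)} → Eq3 X X' → SubD n t σ ρ X → SubD n t σ ρ X'
subD-tr n t σ ρ e sd i j k h = sd i j k (trans (e i j k) h)

respMain : ∀ n t σ ρ → RespectsPointwise₃ {3 ^ n} (λ X → 𝟙 ⌊ isSTS? X ×-dec subD? n t σ ρ X ⌋)
respMain n t σ ρ X X' e = cong 𝟙 (dec-eq (isSTS? X ×-dec subD? n t σ ρ X) (isSTS? X' ×-dec subD? n t σ ρ X')
  (λ { (a , b) → sts-tr e a , subD-tr n t σ ρ e b }) (λ { (a , b) → sts-tr (sym3 e) a , subD-tr n t σ ρ (sym3 e) b }))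

productFin-𝟙 : ∀ K (b : Fin K → Bool) → productFin K (λ q → 𝟙 (b q)) ≡ 𝟙 (allFin b)
productFin-𝟙 zero b = refl
productFin-𝟙 (suc K) b = trans (cong (𝟙 (b zero) *_) (productFin-𝟙 K (λ q → b (suc q)))) (sym (𝟙-∧ (b zero) _))

∧-intro : ∀ {x y} → x ≡ true → y ≡ true → x ∧ y ≡ true
∧-intro refl refl = refl

∧-fst : ∀ {x y} → x ∧ y ≡ true → x ≡ true
∧-fst {true} e = refl
∧-snd : ∀ {x y} → x ∧ y ≡ true → y ≡ true
∧-snd {true} e = e

module Counting (n t : ℕ) (σ : Fin (3 ^ n) → Vec (Fin 3) n) (bij : Bijective _≡_ _≡_ σ)
             (ρ : Fin (n ∸ t) → Fin n) (si : StrictlyIncreasing ρ) (t≤n : t N.≤ n) where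

  open Correspondence n t σ bij ρ si t≤n

  stsIndicator : (Fin TT → Bool) → ℕ
  stsIndicator Z = 𝟙 ⌊ isSTS? (unflatten {T} Z) ⌋

  tdIndicator : (Fin TT → Bool) → ℕ
  tdIndicator Z = 𝟙 ⌊ isTD? (unflatten {T} Z) ⌋

  stsIndicator-resp : RespectsPointwise stsIndicator
  stsIndicator-resp Z Z' e = respSTS (unflatten {T} Z) (unflatten {T} Z') (λ i j k → e (combine (combine i j) k))

  tdIndicator-resp : RespectsPointwise tdIndicator
  tdIndicator-resp Z Z' e = respTD (unflatten {T} Z) (unflatten {T} Z') (λ i j k → e (combine (combine i j) k))

  allFibresSTS : (Fin (M * TT) → Bool) → ℕ
  allFibresSTS Y = productFin M (λ q → stsIndicator (λ w → Y (combine q w)))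

  allLinesTD : (Fin (L * TT) → Bool) → ℕ
  allLinesTD Y = productFin L (λ l → tdIndicator (λ w → Y (combine l w)))

  fibresAndLines : (Fin (M * TT + L * TT) → Bool) → ℕ
  fibresAndLines Y = allFibresSTS (λ i → Y (i ↑ˡ (L * TT))) * allLinesTD (λ j → Y ((M * TT) ↑ʳ j))

  allFibresSTS-resp : RespectsPointwise allFibresSTS
  allFibresSTS-resp Y Y' e = productFin-cong M (λ q → stsIndicator-resp (λ w → Y (combine q w)) (λ w → Y' (combine q w)) (λ w → e (combine q w)))

  allLinesTD-resp : RespectsPointwise allLinesTD
  allLinesTD-resp Y Y' e = productFin-cong L (λ l → tdIndicator-resp (λ w → Y (combine l w)) (λ w → Y' (combine l w)) (λ w → e (combine l w)))

  fibresAndLines-resp : RespectsPointwise fibresAndLines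
  fibresAndLines-resp Y Y' e = cong₂ _*_ (allFibresSTS-resp (λ i → Y (i ↑ˡ (L * TT))) (λ i → Y' (i ↑ˡ (L * TT))) (λ i → e (i ↑ˡ (L * TT))))
                       (allLinesTD-resp (λ j → Y ((M * TT) ↑ʳ j)) (λ j → Y' ((M * TT) ↑ʳ j)) (λ j → e ((M * TT) ↑ʳ j)))

  isSTS×SubD? : (X : Blocks V) → Dec (IsSTS X × SubD n t σ ρ X)
  isSTS×SubD? X = isSTS? X ×-dec subD? n t σ ρ X

  s′-indicator : (Fin N3 → Bool) → ℕ
  s′-indicator W = 𝟙 ⌊ isSTS×SubD? (unflatten {V} W) ⌋

  offIm : ∀ r → inImage ι r ≡ false → OffImage ι r
  offIm r eq u e = true≢false (trans (sym (subst (λ z → eqb (ι u) z ≡ true) e (eqb-refl (ι u)))) (anyFin-false (λ u → eqb (ι u) r) eq u))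

  block-in-image : ∀ W → (∀ r → OffImage ι r → W r ≡ false) → ∀ i j k → unflatten {V} W i j k ≡ true → Σ _ λ u → ι u ≡ tripleCode i j k
  block-in-image W hW i j k xe = helper (inImage ι (tripleCode i j k)) refl
    where
    helper : (b : Bool) → inImage ι (tripleCode i j k) ≡ b → Σ _ λ u → ι u ≡ tripleCode i j k
    helper true eq = proj₁ (anyFin-true (λ u → eqb (ι u) (tripleCode i j k)) eq) ,
                     eqb-true _ _ (proj₂ (anyFin-true (λ u → eqb (ι u) (tripleCode i j k)) eq))
    helper false eq = ⊥-elim (true≢false (trans (sym xe) (hW (tripleCode i j k) (offIm (tripleCode i j k) eq))))

  count-on-image : ∀ W → (∀ r → OffImage ι r → W r ≡ false) → s′-indicator W ≡ fibresAndLines (λ u → W (ι u))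
  count-on-image W hW = trans (cong 𝟙 (bool-ext to from)) (sym eqG)
    where
    X = unflatten {V} W
    bS : Fin M → Bool
    bS q = ⌊ isSTS? (fibreSystem X q) ⌋
    bT : Fin L → Bool
    bT l = ⌊ isTD? (lineDesign X l) ⌋
    eqG : fibresAndLines (λ u → W (ι u)) ≡ 𝟙 (allFin bS ∧ allFin bT)
    eqG = trans (cong₂ _*_ (trans (productFin-cong M (λ q → respSTS (unflatten {T} (λ w → W (ι (combine q w ↑ˡ (L * TT))))) (fibreSystem X q) (λ x y z → cong W (ι-F q x y z)))) (productFin-𝟙 M bS))
                           (trans (productFin-cong L (λ l → respTD (unflatten {T} (λ w → W (ι ((M * TT) ↑ʳ combine l w)))) (lineDesign X l) (λ x y z → cong W (ι-L l x y z)))) (productFin-𝟙 L bT)))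
                (sym (𝟙-∧ (allFin bS) (allFin bT)))
    to : ⌊ isSTS×SubD? X ⌋ ≡ true → allFin bS ∧ allFin bT ≡ true
    to e = ∧-intro (allFin-complete bS (λ q → ⌊⌋-complete (isSTS? (fibreSystem X q)) (fibreSystem-isSTS X sts gd q)))
                              (allFin-complete bT (λ l → ⌊⌋-complete (isTD? (lineDesign X l)) (lineDesign-isTD X sts gd l)))
      where
      sts = proj₁ (⌊⌋-sound (isSTS×SubD? X) e)
      gd = SubD⇒InD-Blocks X (proj₂ (⌊⌋-sound (isSTS×SubD? X) e))
    from : allFin bS ∧ allFin bT ≡ true → ⌊ isSTS×SubD? X ⌋ ≡ true
    from e = ⌊⌋-complete (isSTS×SubD? X) (Gluing.glued-isSTS X sts' td' img , Gluing.glued-SubD X sts' td' img)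
      where
      sts' : ∀ q → IsSTS (fibreSystem X q)
      sts' q = ⌊⌋-sound (isSTS? (fibreSystem X q)) (allFin-sound bS (∧-fst {allFin bS} e) q)
      td' : ∀ l → IsTD (lineDesign X l)
      td' l = ⌊⌋-sound (isTD? (lineDesign X l)) (allFin-sound bT (∧-snd {allFin bS} e) l)
      img = block-in-image W hW

  count-off-image : ∀ W r → OffImage ι r → W r ≡ true → s′-indicator W ≡ 0
  count-off-image W r off wr with isSTS×SubD? (unflatten {V} W)
  ... | no _ = refl
  ... | yes (sts , sub) = ⊥-elim (off (proj₁ I) (trans (proj₂ I) cr))
    where
    ij = proj₁ (remQuot {V * V} V r)
    k = proj₂ (remQuot {V * V} V r)
    i = proj₁ (remQuot {V} V ij)
    j = proj₂ (remQuot {V} V ij)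
    cr : tripleCode i j k ≡ r
    cr = trans (cong (λ a → combine a k) (FP.combine-remQuot {V} V ij)) (FP.combine-remQuot {V * V} V r)
    xt : unflatten {V} W i j k ≡ true
    xt = trans (cong W cr) wr
    G0 = SubD⇒InD-Blocks _ sub i j k xt
    I = collinear-in-image i j k (proj₁ G0) (proj₂ G0)

  s′≡product : s′ n t σ ρ ≡ N₁ T ^ M * N₃ T ^ L
  s′≡product = begin
    s′ n t σ ρ
      ≡⟨ countBlocks V isSTS×SubD? (respMain n t σ ρ) ⟩
    sumSubsets N3 s′-indicator
      ≡⟨ sumSubsets-support N3 ι ι-inj s′-indicator fibresAndLines fibresAndLines-resp count-on-image count-off-image ⟩
    sumSubsets (M * TT + L * TT) fibresAndLines
      ≡⟨ sumSubsets-↑ (M * TT) (L * TT) allFibresSTS allLinesTD allFibresSTS-resp ⟩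
    sumSubsets (M * TT) allFibresSTS * sumSubsets (L * TT) allLinesTD
      ≡⟨ cong₂ _*_ (sumSubsets-power M TT stsIndicator stsIndicator-resp) (sumSubsets-power L TT tdIndicator tdIndicator-resp) ⟩
    sumSubsets TT stsIndicator ^ M * sumSubsets TT tdIndicator ^ L
      ≡⟨ cong₂ (λ x y → x ^ M * y ^ L) (sym (countBlocks T isSTS? respSTS)) (sym (countBlocks T isTD? respTD)) ⟩
    N₁ T ^ M * N₃ T ^ L ∎
    where open ≡-Reasoning

theorem3p9 : (n t : ℕ) → 2 ≤ n → 1 ≤ t → t ≤ n ∸ 1
    → (σ : Fin (3 ^ n) → Vec (Fin 3) n) → Bijective _≡_ _≡_ σ
    → (ρ : Fin (n ∸ t) → Fin n) → StrictlyIncreasing ρ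
    → s′ n t σ ρ
    ≡ N₁ (3 ^ t) ^ (3 ^ (n ∸ t))
    * N₃ (3 ^ t) ^ ((3 ^ (n ∸ t) * (3 ^ (n ∸ t) ∸ 1)) / 6)
theorem3p9 n t _ _ h σ bij ρ si =
  trans (Counting.s′≡product n t σ bij ρ si t≤n)
        (cong (λ e → N₁ (3 ^ t) ^ (3 ^ (n ∸ t)) * N₃ (3 ^ t) ^ e) (LineCount.#lines≡ (n ∸ t)))
  where
  t≤n : t ≤ n
  t≤n = NP.≤-trans h (NP.m∸n≤m n 1)
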